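{- Let $(\alpha_L)_{L\ge 0},(\beta_L)_{L\ge0}$ be a Bailey pair relative to $a$ and $q^3$. Define sequences $(\alpha'_L)_{L\ge0},(\beta'_L)_{L\ge0}$ by \[ \alpha'_{3L}=a^L q^{3L^2}\alpha_L,\qquad \alpha'_{3L+1}=\alpha'_{3L+2}=0, \] \[ \beta'_L=\frac{(a;q^3)_L}{(q;q)_L(a;q)_{2L}}\sum_{r=0}^{\lfloor L/3\rfloor}\frac{(q^{ -L};q)_{3r}\,q^{3r}}{(q^{3-3L}/a;q^3)_r}\,\beta_r . \] Then $(\alpha',\beta')$ is a Bailey pair relative to $a$ and $q$.
   Context: For $n\ge 0$, $(x;p)_n=\prod_{i=0}^{n-1}(1-xp^i)$. Sequences $(\alpha_L)_{L\ge0}$, $(\beta_L)_{L\ge0}$ form a Bailey pair relative to $a$ and base $p$ if $\beta_L=\sum_{r=0}^{L}\frac{\alpha_r}{(p;p)_{L-r}(ap;p)_{L+r}}$ for all $L\ge 0$. Here $a,q$ are indeterminates (generic parameters). -}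

module Defs where

open import Level using (Level; _⊔_) renaming (suc to lsuc)
open import Algebra.Bundles using (CommutativeRing)
open import Data.Nat using (ℕ; zero; suc; _∸_; _≤_) renaming (_+_ to _+ℕ_; _*_ to _*ℕ_)
open import Data.Nat.DivMod using (_/_; _%_)
open import Relation.Nullary using (¬_)

-- A field: a commutative ring with 0 ≠ 1 and a total inverse operation
-- (x⁻¹ is an inverse of x whenever x ≉ 0; by convention 0⁻¹ = 0).
-- Division x / y := x * y⁻¹.
record Field (c ℓ : Level) : Set (lsuc (c ⊔ ℓ)) where
  field
    commutativeRing : CommutativeRing c ℓ
  open CommutativeRing commutativeRing public
  field
    _⁻¹        : Carrier → Carrier
    ⁻¹-cong    : ∀ {x y} → x ≈ y → x ⁻¹ ≈ y ⁻¹
    ⁻¹-inverse : ∀ x → ¬ (x ≈ 0#) → x * x ⁻¹ ≈ 1#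
    ⁻¹-zero    : 0# ⁻¹ ≈ 0#
    0≉1        : ¬ (0# ≈ 1#)

  infixl 7 _÷_
  _÷_ : Carrier → Carrier → Carrier
  x ÷ y = x * y ⁻¹

module FieldOps {c ℓ : Level} (F : Field c ℓ) where
  open Field F

  infixr 8 _^_
  _^_ : Carrier → ℕ → Carrier
  x ^ zero  = 1#
  x ^ suc n = x * x ^ n

  poch : Carrier → Carrier → ℕ → Carrier
  poch x p zero    = 1#
  poch x p (suc n) = poch x p n * (1# - x * p ^ n)

  sumTo : ℕ → (ℕ → Carrier) → Carrier
  sumTo zero    f = f 0
  sumTo (suc n) f = sumTo n f + f (suc n)

  BaileyPair : Carrier → Carrier → (ℕ → Carrier) → (ℕ → Carrier) → Set ℓ
  BaileyPair a p α β =
    ∀ (L : ℕ) → β L ≈ sumTo L (λ r → α r ÷ (poch p p (L ∸ r) * poch (a * p) p (L +ℕ r)))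

  alphaPrime : Carrier → Carrier → (ℕ → Carrier) → ℕ → Carrier
  alphaPrime a q α n with n % 3
  ... | zero  = a ^ (n / 3) * q ^ (3 *ℕ ((n / 3) *ℕ (n / 3))) * α (n / 3)
  ... | suc _ = 0#

  betaPrime : Carrier → Carrier → (ℕ → Carrier) → ℕ → Carrier
  betaPrime a q β L =
    (poch a (q ^ 3) L ÷ (poch q q L * poch a q (2 *ℕ L)))
    * sumTo (L / 3) (λ r →
        (poch ((q ^ L) ⁻¹) q (3 *ℕ r) * q ^ (3 *ℕ r)
           ÷ poch (q ^ 3 * (q ^ (3 *ℕ L)) ⁻¹ ÷ a) (q ^ 3) r)
        * β r)

-- Substituting the base-q³ Bailey pair into β′ and exchanging the two sums, the coefficient
-- of α_k becomes a terminating sum over j.  By the reflection formulas for (q^(−L);q)_(3r) and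
-- (q^(3−3L)/a;q³)_r it is a multiple of the cubic identity
--   Σ_j b^j q^(3j²) (b;q³)_(n−j) (q;q)_n / ((q;q)_(n−3j) (q³;q³)_j (bq³;q³)_j) = (b;q)_(2n) / (bq;q)_n
-- for b = a q^(6k) and n = L − 3k, and what remains is a^k q^(3k²) / ((q;q)_(L−3k) (aq;q)_(L+3k)),
-- the coefficient of α′_(3k) = a^k q^(3k²) α_k.  The cubic identity itself follows by the WZ method:
-- both sides satisfy the same first-order recurrence in n, with an explicit certificate.
module Submission where

open import Algebra using (CommutativeRing; RawRing)
import Algebra.Solver.CommutativeMonoid as CommutativeMonoidSolver
import Algebra.Solver.Ring
open import Algebra.Solver.Ring.AlmostCommutativeRing using (fromCommutativeRing; _-Raw-AlmostCommutative⟶_)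
open import Data.Maybe using (Maybe; just; nothing)
open import Data.Nat as ℕ using (ℕ; zero; suc; z≤n; s≤s)
import Data.Nat.Properties as ℕ
open import Data.Nat.DivMod using (_/_; _%_; m≡m%n+[m/n]*n; m%n<n; [m+kn]%n≡m%n; m*n%n≡0; m*n/n≡m)
open import Data.Nat.Tactic.RingSolver using (solve-∀)
open import Data.Product as Product using (_,_)
open import Data.Sum using (inj₁; inj₂)
open import Relation.Binary.PropositionalEquality as ≡ using (_≡_)
open import Relation.Nullary using (¬_; yes; no)
open import Defs

-- The library's ring solvers for an arbitrary commutative ring draw their coefficients from the
-- ring itself and need decidable equality there to normalise constants; here ℤ is the coefficient ring.
module IntegerCoefficientSolver {c ℓ} (R : CommutativeRing c ℓ) where

  open CommutativeRing R
  open import Algebra.Properties.Semiring.Mult.TCOptimised semiring using (_×_; 1+×; ×1-homo-*; ×-homo-+)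
  open import Relation.Binary.Reasoning.Setoid setoid
  open import Algebra.Properties.Ring ring using (-‿distribˡ-*; -‿distribʳ-*)
  open import Algebra.Properties.AbelianGroup +-abelianGroup using (⁻¹-∙-comm; ⁻¹-anti-homo‿-)
  open import Algebra.Properties.Group +-group using (⁻¹-involutive; ε⁻¹≈ε)
  open CommutativeMonoidSolver +-commutativeMonoid using (_⊕_; _⊜_) renaming (solve to +-solve)

  private
    -‿cong₂ : ∀ {x x′ y y′} → x ≈ x′ → y ≈ y′ → x - y ≈ x′ - y′
    -‿cong₂ p q = +-cong p (-‿cong q)

    +-interchange : ∀ a b c d → (a + b) + (c + d) ≈ (a + c) + (b + d)
    +-interchange = +-solve 4 (λ a b c d → (a ⊕ b) ⊕ (c ⊕ d) ⊜ (a ⊕ c) ⊕ (b ⊕ d)) refl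

    -‿+-interchange : ∀ a b c d → (a + c) - (b + d) ≈ (a - b) + (c - d)
    -‿+-interchange a b c d = trans (+-congˡ (sym (⁻¹-∙-comm b d))) (+-interchange a c (- b) (- d))

    -‿cancelˡ : ∀ u x y → (u + x) - (u + y) ≈ x - y
    -‿cancelˡ u x y = begin
      (u + x) - (u + y)     ≈⟨ -‿+-interchange u u x y ⟩
      (u - u) + (x - y)     ≈⟨ +-congʳ (-‿inverseʳ u) ⟩
      0# + (x - y)          ≈⟨ +-identityˡ _ ⟩
      x - y                 ∎

    -‿*-expand : ∀ a b c d → (a * c + b * d) - (a * d + b * c) ≈ (a - b) * (c - d)
    -‿*-expand a b c d = sym (begin
      (a - b) * (c - d)                                  ≈⟨ distribʳ (c - d) a (- b) ⟩
      a * (c - d) + - b * (c - d)                        ≈⟨ +-cong (distribˡ a c (- d)) (distribˡ (- b) c (- d)) ⟩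
      (a * c + a * - d) + (- b * c + - b * - d)
        ≈⟨ +-cong (+-congˡ (sym (-‿distribʳ-* a d))) (+-cong (sym (-‿distribˡ-* b c)) neg-neg) ⟩
      (a * c - a * d) + (- (b * c) + b * d)
        ≈⟨ +-solve 4 (λ p q r s → (p ⊕ q) ⊕ (r ⊕ s) ⊜ (p ⊕ s) ⊕ (q ⊕ r)) refl (a * c) (- (a * d)) (- (b * c)) (b * d) ⟩
      (a * c + b * d) + (- (a * d) + - (b * c))          ≈⟨ +-congˡ (⁻¹-∙-comm (a * d) (b * c)) ⟩
      (a * c + b * d) - (a * d + b * c)                  ∎)
      where
      neg-neg : - b * - d ≈ b * d
      neg-neg = trans (sym (-‿distribˡ-* b (- d))) (trans (-‿cong (sym (-‿distribʳ-* b d))) (⁻¹-involutive (b * d)))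

  -- (m , n) stands for m − n.  Normal forms are compared with refl, so the coefficient
  -- operations normalise to pairs with a zero component.
  ℕ² : Set
  ℕ² = ℕ Product.× ℕ

  normalise : ℕ² → ℕ²
  normalise (suc m , suc n) = normalise (m , n)
  normalise p = p

  ℤ-rawRing : RawRing _ _
  ℤ-rawRing = record
    { Carrier = ℕ²
    ; _≈_ = _≡_
    ; _+_ = λ { (a , b) (c , d) → normalise (a ℕ.+ c , b ℕ.+ d) }
    ; _*_ = λ { (a , b) (c , d) → normalise (a ℕ.* c ℕ.+ b ℕ.* d , a ℕ.* d ℕ.+ b ℕ.* c) }
    ; -_ = λ { (a , b) → (b , a) }
    ; 0# = (0 , 0)
    ; 1# = (1 , 0)
    }

  difference : ℕ² → Carrier
  difference (m , n) = m × 1# - n × 1#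

  -- Constants must evaluate to 1# and 0# on the nose, for the solver's refl.
  ⟦_⟧ℤ : ℕ² → Carrier
  ⟦ m , zero ⟧ℤ = m × 1#
  ⟦ m , suc n ⟧ℤ = difference (m , suc n)

  ⟦⟧≈difference : ∀ p → ⟦ p ⟧ℤ ≈ difference p
  ⟦⟧≈difference (m , zero) = sym (trans (+-congˡ ε⁻¹≈ε) (+-identityʳ (m × 1#)))
  ⟦⟧≈difference (m , suc n) = refl

  difference-normalise : ∀ p → difference (normalise p) ≈ difference p
  difference-normalise (suc m , suc n) =
    trans (difference-normalise (m , n)) (sym (trans (-‿cong₂ (1+× m 1#) (1+× n 1#)) (-‿cancelˡ 1# _ _)))
  difference-normalise (zero , n) = refl
  difference-normalise (suc m , zero) = refl

  difference-cong : ∀ a b c d → a ℕ.+ d ≡ c ℕ.+ b → difference (a , b) ≈ difference (c , d)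
  difference-cong a b c d eq = begin
    a × 1# - b × 1#                              ≈⟨ sym (-‿cancelˡ (d × 1#) _ _) ⟩
    (d × 1# + a × 1#) - (d × 1# + b × 1#)        ≈⟨ -‿cong₂ (trans (+-comm _ _) (×-sum a d)) (×-sum d b) ⟩
    (a ℕ.+ d) × 1# - (d ℕ.+ b) × 1#              ≈⟨ -‿cong₂ (reflexive (≡.cong (_× 1#) eq)) (reflexive (≡.cong (_× 1#) (ℕ.+-comm d b))) ⟩
    (c ℕ.+ b) × 1# - (b ℕ.+ d) × 1#              ≈⟨ -‿cong₂ (sym (×-sum c b)) (sym (×-sum b d)) ⟩
    (c × 1# + b × 1#) - (b × 1# + d × 1#)        ≈⟨ -‿cong₂ (+-comm _ _) refl ⟩
    (b × 1# + c × 1#) - (b × 1# + d × 1#)        ≈⟨ -‿cancelˡ (b × 1#) _ _ ⟩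
    c × 1# - d × 1#                              ∎
    where
    ×-sum : ∀ m n → m × 1# + n × 1# ≈ (m ℕ.+ n) × 1#
    ×-sum m n = sym (×-homo-+ 1# m n)

  ⟦⟧-normalise : ∀ p → ⟦ normalise p ⟧ℤ ≈ difference p
  ⟦⟧-normalise p = trans (⟦⟧≈difference (normalise p)) (difference-normalise p)

  ⟦⟧-homomorphism : ℤ-rawRing -Raw-AlmostCommutative⟶ fromCommutativeRing R
  ⟦⟧-homomorphism = record
    { ⟦_⟧ = ⟦_⟧ℤ
    ; +-homo = λ { (a , b) (c , d) → begin
        ⟦ normalise (a ℕ.+ c , b ℕ.+ d) ⟧ℤ          ≈⟨ ⟦⟧-normalise (a ℕ.+ c , b ℕ.+ d) ⟩
        (a ℕ.+ c) × 1# - (b ℕ.+ d) × 1#            ≈⟨ -‿cong₂ (×-homo-+ 1# a c) (×-homo-+ 1# b d) ⟩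
        (a × 1# + c × 1#) - (b × 1# + d × 1#)      ≈⟨ -‿+-interchange _ _ _ _ ⟩
        difference (a , b) + difference (c , d)    ≈⟨ sym (+-cong (⟦⟧≈difference (a , b)) (⟦⟧≈difference (c , d))) ⟩
        ⟦ a , b ⟧ℤ + ⟦ c , d ⟧ℤ                    ∎ }
    ; *-homo = λ { (a , b) (c , d) → begin
        ⟦ normalise (a ℕ.* c ℕ.+ b ℕ.* d , a ℕ.* d ℕ.+ b ℕ.* c) ⟧ℤ
          ≈⟨ ⟦⟧-normalise (a ℕ.* c ℕ.+ b ℕ.* d , a ℕ.* d ℕ.+ b ℕ.* c) ⟩
        (a ℕ.* c ℕ.+ b ℕ.* d) × 1# - (a ℕ.* d ℕ.+ b ℕ.* c) × 1#
          ≈⟨ -‿cong₂ (×-homo-+ 1# (a ℕ.* c) (b ℕ.* d)) (×-homo-+ 1# (a ℕ.* d) (b ℕ.* c)) ⟩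
        ((a ℕ.* c) × 1# + (b ℕ.* d) × 1#) - ((a ℕ.* d) × 1# + (b ℕ.* c) × 1#)
          ≈⟨ -‿cong₂ (+-cong (×1-homo-* a c) (×1-homo-* b d)) (+-cong (×1-homo-* a d) (×1-homo-* b c)) ⟩
        (a × 1# * (c × 1#) + b × 1# * (d × 1#)) - (a × 1# * (d × 1#) + b × 1# * (c × 1#))
          ≈⟨ -‿*-expand _ _ _ _ ⟩
        difference (a , b) * difference (c , d)
          ≈⟨ sym (*-cong (⟦⟧≈difference (a , b)) (⟦⟧≈difference (c , d))) ⟩
        ⟦ a , b ⟧ℤ * ⟦ c , d ⟧ℤ ∎ }
    ; -‿homo = λ { (a , b) → trans (⟦⟧≈difference (b , a))
        (trans (sym (⁻¹-anti-homo‿- _ _)) (-‿cong (sym (⟦⟧≈difference (a , b))))) }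
    ; 0-homo = refl
    ; 1-homo = refl
    }

  _≟ℤ_ : ∀ p q → Maybe (⟦ p ⟧ℤ ≈ ⟦ q ⟧ℤ)
  (a , b) ≟ℤ (c , d) with a ℕ.+ d ℕ.≟ c ℕ.+ b
  ... | yes eq = just (trans (⟦⟧≈difference (a , b))
                        (trans (difference-cong a b c d eq) (sym (⟦⟧≈difference (c , d)))))
  ... | no _ = nothing

  open Algebra.Solver.Ring ℤ-rawRing (fromCommutativeRing R) ⟦⟧-homomorphism _≟ℤ_ public
    using (Polynomial; solve; _:+_; _:*_; _:-_; :-_; _:=_; con)

  𝟙 : ∀ {n} → Polynomial n
  𝟙 = con (1 , 0)

module _ {c ℓ} (F : Field c ℓ) where
  open Field F hiding (zero)
  open FieldOps F
  open IntegerCoefficientSolver commutativeRing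
  open import Algebra.Properties.Group +-group using (ε⁻¹≈ε; x∙y⁻¹≈ε⇒x≈y)
  open import Relation.Binary.Reasoning.Setoid setoid
  open import Relation.Binary.Properties.Setoid setoid using (≉-respˡ)
  open CommutativeMonoidSolver *-commutativeMonoid using (_⊕_; _⊜_) renaming (solve to *-solve; id to ε)

  *-interchange : ∀ a b c d → (a * b) * (c * d) ≈ (a * c) * (b * d)
  *-interchange = *-solve 4 (λ a b c d → (a ⊕ b) ⊕ (c ⊕ d) ⊜ (a ⊕ c) ⊕ (b ⊕ d)) refl

  ⁻¹-inverseˡ : ∀ x → x ≉ 0# → x ⁻¹ * x ≈ 1#
  ⁻¹-inverseˡ x x≉0 = trans (*-comm _ _) (⁻¹-inverse x x≉0)

  *-≈0ʳ : ∀ x {y} → y ≈ 0# → x * y ≈ 0#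
  *-≈0ʳ x y≈0 = trans (*-congˡ y≈0) (zeroʳ x)

  *-≈0ˡ : ∀ {x} y → x ≈ 0# → x * y ≈ 0#
  *-≈0ˡ y x≈0 = trans (*-congʳ x≈0) (zeroˡ y)

  1≉0 : 1# ≉ 0#
  1≉0 1≈0 = 0≉1 (sym 1≈0)

  *-≉0 : ∀ {x y} → x ≉ 0# → y ≉ 0# → x * y ≉ 0#
  *-≉0 {x} {y} x≉0 y≉0 xy≈0 = y≉0 (begin
    y                  ≈⟨ sym (*-identityˡ y) ⟩
    1# * y             ≈⟨ *-congʳ (sym (⁻¹-inverseˡ x x≉0)) ⟩
    (x ⁻¹ * x) * y     ≈⟨ *-assoc (x ⁻¹) x y ⟩
    x ⁻¹ * (x * y)     ≈⟨ *-congˡ xy≈0 ⟩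
    x ⁻¹ * 0#          ≈⟨ zeroʳ _ ⟩
    0#                 ∎)

  *-÷-cancel : ∀ x {d} → d ≉ 0# → (x * d) ÷ d ≈ x
  *-÷-cancel x {d} d≉0 = trans (*-assoc x d (d ⁻¹)) (trans (*-congˡ (⁻¹-inverse d d≉0)) (*-identityʳ x))

  ÷-*-cancel : ∀ x {d} → d ≉ 0# → (x ÷ d) * d ≈ x
  ÷-*-cancel x {d} d≉0 = trans (*-assoc x (d ⁻¹) d) (trans (*-congˡ (⁻¹-inverseˡ d d≉0)) (*-identityʳ x))

  *-cancelʳ : ∀ {x y z} → z ≉ 0# → x * z ≈ y * z → x ≈ y
  *-cancelʳ {x} {y} {z} z≉0 xz≈yz = begin
    x              ≈⟨ sym (*-÷-cancel x z≉0) ⟩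
    (x * z) ÷ z    ≈⟨ *-congʳ xz≈yz ⟩
    (y * z) ÷ z    ≈⟨ *-÷-cancel y z≉0 ⟩
    y              ∎

  ÷-intro : ∀ {u v d} → d ≉ 0# → u ≈ v * d → u ÷ d ≈ v
  ÷-intro {v = v} d≉0 u≈vd = trans (*-congʳ u≈vd) (*-÷-cancel v d≉0)

  ÷-cross : ∀ {u d v e} → d ≉ 0# → e ≉ 0# → u * e ≈ v * d → u ÷ d ≈ v ÷ e
  ÷-cross {u} {d} {v} {e} d≉0 e≉0 ue≈vd = ÷-intro d≉0 (*-cancelʳ e≉0 (begin
    u * e                  ≈⟨ ue≈vd ⟩
    v * d                  ≈⟨ *-congʳ (sym (÷-*-cancel v e≉0)) ⟩
    ((v ÷ e) * e) * d      ≈⟨ *-solve 3 (λ a b c → (a ⊕ b) ⊕ c ⊜ (a ⊕ c) ⊕ b) refl (v ÷ e) e d ⟩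
    ((v ÷ e) * d) * e      ∎))

  ⁻¹-*-distrib : ∀ {d e} → d ≉ 0# → e ≉ 0# → (d * e) ⁻¹ ≈ d ⁻¹ * e ⁻¹
  ⁻¹-*-distrib {d} {e} d≉0 e≉0 = sym (*-cancelʳ de≉0 (begin
    (d ⁻¹ * e ⁻¹) * (d * e)     ≈⟨ *-interchange (d ⁻¹) (e ⁻¹) d e ⟩
    (d ⁻¹ * d) * (e ⁻¹ * e)     ≈⟨ *-cong (⁻¹-inverseˡ d d≉0) (⁻¹-inverseˡ e e≉0) ⟩
    1# * 1#                     ≈⟨ *-identityˡ 1# ⟩
    1#                          ≈⟨ sym (⁻¹-inverseˡ (d * e) de≉0) ⟩
    (d * e) ⁻¹ * (d * e)        ∎))
    where de≉0 = *-≉0 d≉0 e≉0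

  ÷-*-÷ : ∀ u v {d e} → d ≉ 0# → e ≉ 0# → (u ÷ d) * (v ÷ e) ≈ (u * v) ÷ (d * e)
  ÷-*-÷ u v {d} {e} d≉0 e≉0 = trans (*-interchange u (d ⁻¹) v (e ⁻¹)) (*-congˡ (sym (⁻¹-*-distrib d≉0 e≉0)))

  ÷-÷ : ∀ u {d e} → d ≉ 0# → e ≉ 0# → (u ÷ d) ÷ e ≈ u ÷ (d * e)
  ÷-÷ u {d} {e} d≉0 e≉0 = trans (*-assoc u (d ⁻¹) (e ⁻¹)) (*-congˡ (sym (⁻¹-*-distrib d≉0 e≉0)))

  1-x≉0 : ∀ {x} → x ≉ 1# → 1# - x ≉ 0#
  1-x≉0 {x} x≉1 1-x≈0 = x≉1 (begin
    x                  ≈⟨ solve 1 (λ x → x := 𝟙 :- (𝟙 :- x)) refl x ⟩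
    1# - (1# - x)      ≈⟨ +-congˡ (-‿cong 1-x≈0) ⟩
    1# - 0#            ≈⟨ solve 0 (𝟙 :- con (0 , 0) := 𝟙) refl ⟩
    1#                 ∎)

  ^-cong : ∀ {x y} n → x ≈ y → x ^ n ≈ y ^ n
  ^-cong zero x≈y = refl
  ^-cong (suc n) x≈y = *-cong x≈y (^-cong n x≈y)

  ^-≡ : ∀ x {m n} → m ≡ n → x ^ m ≈ x ^ n
  ^-≡ x ≡.refl = refl

  ^-+ : ∀ x m n → x ^ (m ℕ.+ n) ≈ x ^ m * x ^ n
  ^-+ x zero n = sym (*-identityˡ _)
  ^-+ x (suc m) n = trans (*-congˡ (^-+ x m n)) (sym (*-assoc x (x ^ m) (x ^ n)))

  ^-* : ∀ x m n → x ^ (m ℕ.* n) ≈ (x ^ n) ^ m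
  ^-* x zero n = refl
  ^-* x (suc m) n = trans (^-+ x n (m ℕ.* n)) (*-congˡ (^-* x m n))

  ^-^ : ∀ x m n → (x ^ m) ^ n ≈ x ^ (m ℕ.* n)
  ^-^ x m n = trans (sym (^-* x n m)) (^-≡ x (ℕ.*-comm n m))

  ^-*-comm : ∀ x m n → (x ^ m) ^ n ≈ (x ^ n) ^ m
  ^-*-comm x m n = trans (^-^ x m n) (^-* x m n)

  *-^ : ∀ x y n → (x * y) ^ n ≈ x ^ n * y ^ n
  *-^ x y zero = sym (*-identityˡ 1#)
  *-^ x y (suc n) = trans (*-congˡ (*-^ x y n)) (*-interchange x y (x ^ n) (y ^ n))

  ^-≉0 : ∀ {x} n → x ≉ 0# → x ^ n ≉ 0#
  ^-≉0 zero x≉0 = 1≉0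
  ^-≉0 (suc n) x≉0 = *-≉0 x≉0 (^-≉0 n x≉0)

  poch-cong : ∀ {x y} p n → x ≈ y → poch x p n ≈ poch y p n
  poch-cong p zero x≈y = refl
  poch-cong p (suc n) x≈y = *-cong (poch-cong p n x≈y) (+-congˡ (-‿cong (*-congʳ x≈y)))

  poch-≡ : ∀ x p {m n} → m ≡ n → poch x p m ≈ poch x p n
  poch-≡ x p ≡.refl = refl

  poch-+ : ∀ x p m n → poch x p (m ℕ.+ n) ≈ poch x p m * poch (x * p ^ m) p n
  poch-+ x p m zero = trans (poch-≡ x p (ℕ.+-identityʳ m)) (sym (*-identityʳ _))
  poch-+ x p m (suc n) = begin
    poch x p (m ℕ.+ suc n)                                          ≈⟨ poch-≡ x p (ℕ.+-suc m n) ⟩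
    poch x p (m ℕ.+ n) * (1# - x * p ^ (m ℕ.+ n))                   ≈⟨ *-cong (poch-+ x p m n) (+-congˡ (-‿cong x*pᵐ⁺ⁿ)) ⟩
    (poch x p m * poch (x * p ^ m) p n) * (1# - (x * p ^ m) * p ^ n) ≈⟨ *-assoc _ _ _ ⟩
    poch x p m * poch (x * p ^ m) p (suc n)                         ∎
    where
    x*pᵐ⁺ⁿ : x * p ^ (m ℕ.+ n) ≈ (x * p ^ m) * p ^ n
    x*pᵐ⁺ⁿ = trans (*-congˡ (^-+ p m n)) (sym (*-assoc x (p ^ m) (p ^ n)))

  poch-shift : ∀ x p m → poch x p m * (1# - x * p ^ m) ≈ (1# - x) * poch (x * p) p m
  poch-shift x p m = trans (poch-+ x p 1 m)
    (*-cong (solve 1 (λ x → 𝟙 :* (𝟙 :- x :* 𝟙) := 𝟙 :- x) refl x)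
            (poch-cong p m (*-congˡ (*-identityʳ p))))

  poch-≉0 : ∀ {x p} n → (∀ i → i ℕ.< n → x * p ^ i ≉ 1#) → poch x p n ≉ 0#
  poch-≉0 zero _ = 1≉0
  poch-≉0 (suc n) x*pⁱ≉1 = *-≉0 (poch-≉0 n (λ i i<n → x*pⁱ≉1 i (ℕ.m<n⇒m<1+n i<n))) (1-x≉0 (x*pⁱ≉1 n ℕ.≤-refl))

  sumTo-cong : ∀ n {f g : ℕ → Carrier} → (∀ i → i ℕ.≤ n → f i ≈ g i) → sumTo n f ≈ sumTo n g
  sumTo-cong zero f≈g = f≈g 0 z≤n
  sumTo-cong (suc n) f≈g = +-cong (sumTo-cong n (λ i i≤n → f≈g i (ℕ.m≤n⇒m≤1+n i≤n))) (f≈g (suc n) ℕ.≤-refl)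

  sumTo-≡ : ∀ (f : ℕ → Carrier) {m n} → m ≡ n → sumTo m f ≈ sumTo n f
  sumTo-≡ f ≡.refl = refl

  *-distribˡ-sumTo : ∀ x n (f : ℕ → Carrier) → x * sumTo n f ≈ sumTo n (λ i → x * f i)
  *-distribˡ-sumTo x zero f = refl
  *-distribˡ-sumTo x (suc n) f = trans (distribˡ x _ _) (+-congʳ (*-distribˡ-sumTo x n f))

  *-distribʳ-sumTo : ∀ x n (f : ℕ → Carrier) → sumTo n f * x ≈ sumTo n (λ i → f i * x)
  *-distribʳ-sumTo x zero f = refl
  *-distribʳ-sumTo x (suc n) f = trans (distribʳ x _ _) (+-congʳ (*-distribʳ-sumTo x n f))

  sumTo-- : ∀ n (f g : ℕ → Carrier) → sumTo n (λ i → f i - g i) ≈ sumTo n f - sumTo n g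
  sumTo-- zero f g = refl
  sumTo-- (suc n) f g = trans (+-congʳ (sumTo-- n f g))
    (solve 4 (λ a b c d → (a :- b) :+ (c :- d) := (a :+ c) :- (b :+ d)) refl _ _ _ _)

  sumTo-telescope : ∀ n (h : ℕ → Carrier) → sumTo n (λ j → h (suc j) - h j) ≈ h (suc n) - h 0
  sumTo-telescope zero h = refl
  sumTo-telescope (suc n) h = trans (+-congʳ (sumTo-telescope n h))
    (solve 3 (λ a b c → (b :- a) :+ (c :- b) := c :- a) refl (h 0) (h (suc n)) (h (suc (suc n))))

  sumTo-pad : ∀ n k (f : ℕ → Carrier) → (∀ i → 0 ℕ.< i → i ℕ.≤ k → f (n ℕ.+ i) ≈ 0#) →
              sumTo (n ℕ.+ k) f ≈ sumTo n f
  sumTo-pad n zero f _ = sumTo-≡ f (ℕ.+-identityʳ n)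
  sumTo-pad n (suc k) f f≈0 = begin
    sumTo (n ℕ.+ suc k) f                  ≈⟨ sumTo-≡ f (ℕ.+-suc n k) ⟩
    sumTo (n ℕ.+ k) f + f (suc (n ℕ.+ k))  ≈⟨ +-cong (sumTo-pad n k f (λ i 0<i i≤k → f≈0 i 0<i (ℕ.m≤n⇒m≤1+n i≤k)))
                                                     (trans (reflexive (≡.cong f (≡.sym (ℕ.+-suc n k)))) (f≈0 (suc k) (s≤s z≤n) ℕ.≤-refl)) ⟩
    sumTo n f + 0#                         ≈⟨ +-identityʳ _ ⟩
    sumTo n f                              ∎

  sumTo-triangle : ∀ M (f : ℕ → ℕ → Carrier) →
    sumTo M (λ r → sumTo r (f r)) ≈ sumTo M (λ k → sumTo (M ℕ.∸ k) (λ j → f (k ℕ.+ j) k))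
  sumTo-triangle zero f = refl
  sumTo-triangle (suc M) f = begin
    sumTo M (λ r → sumTo r (f r)) + sumTo (suc M) (f (suc M))      ≈⟨ +-congʳ (sumTo-triangle M f) ⟩
    sumTo M column + (sumTo M (f (suc M)) + f (suc M) (suc M))     ≈⟨ sym (+-assoc _ _ _) ⟩
    (sumTo M column + sumTo M (f (suc M))) + f (suc M) (suc M)     ≈⟨ +-cong (sym (sumTo-+ M column (f (suc M)))) corner ⟩
    sumTo M (λ k → column k + f (suc M) k) + column′ (suc M)       ≈⟨ +-congʳ (sumTo-cong M extend) ⟩
    sumTo M column′ + column′ (suc M)                              ∎
    where
    column column′ : ℕ → Carrier
    column k = sumTo (M ℕ.∸ k) (λ j → f (k ℕ.+ j) k)
    column′ k = sumTo (suc M ℕ.∸ k) (λ j → f (k ℕ.+ j) k)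
    sumTo-+ : ∀ n (g h : ℕ → Carrier) → sumTo n (λ i → g i + h i) ≈ sumTo n g + sumTo n h
    sumTo-+ zero g h = refl
    sumTo-+ (suc n) g h = trans (+-congʳ (sumTo-+ n g h))
      (solve 4 (λ a b c d → (a :+ b) :+ (c :+ d) := (a :+ c) :+ (b :+ d)) refl _ _ _ _)
    corner : f (suc M) (suc M) ≈ column′ (suc M)
    corner = trans (reflexive (≡.cong (λ r → f r (suc M)) (≡.sym (ℕ.+-identityʳ (suc M)))))
                   (sumTo-≡ (λ j → f (suc M ℕ.+ j) (suc M)) (≡.sym (ℕ.n∸n≡0 M)))
    extend : ∀ k → k ℕ.≤ M → column k + f (suc M) k ≈ column′ k
    extend k k≤M = sym (begin
      column′ k                                      ≈⟨ sumTo-≡ (λ j → f (k ℕ.+ j) k) (ℕ.+-∸-assoc 1 k≤M) ⟩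
      sumTo (suc (M ℕ.∸ k)) (λ j → f (k ℕ.+ j) k)   ≈⟨ +-congˡ (reflexive (≡.cong (λ r → f r k) k+[M∸k+1]≡M+1)) ⟩
      column k + f (suc M) k                         ∎)
      where
      k+[M∸k+1]≡M+1 : k ℕ.+ suc (M ℕ.∸ k) ≡ suc M
      k+[M∸k+1]≡M+1 = ≡.trans (ℕ.+-suc k (M ℕ.∸ k)) (≡.cong suc (ℕ.m+[n∸m]≡n k≤M))

  sumTo-multiples : ∀ d .{{_ : ℕ.NonZero d}} (g : ℕ → Carrier) →
    (∀ k r → 0 ℕ.< r → r ℕ.< d → g (d ℕ.* k ℕ.+ r) ≈ 0#) →
    ∀ L → sumTo L g ≈ sumTo (L / d) (λ k → g (d ℕ.* k))
  sumTo-multiples d@(suc d′) g g≈0 L = begin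
    sumTo L g
      ≈⟨ sumTo-≡ g L≡ ⟩
    sumTo (d ℕ.* (L / d) ℕ.+ L % d) g
      ≈⟨ sumTo-pad _ (L % d) g (λ i 0<i i≤ → g≈0 (L / d) i 0<i (ℕ.≤-<-trans i≤ (m%n<n L d))) ⟩
    sumTo (d ℕ.* (L / d)) g
      ≈⟨ multiples (L / d) ⟩
    sumTo (L / d) (λ k → g (d ℕ.* k)) ∎
    where
    L≡ : L ≡ d ℕ.* (L / d) ℕ.+ L % d
    L≡ = ≡.trans (m≡m%n+[m/n]*n L d) (≡.trans (ℕ.+-comm (L % d) _) (≡.cong (ℕ._+ L % d) (ℕ.*-comm (L / d) d)))
    multiples : ∀ m → sumTo (d ℕ.* m) g ≈ sumTo m (λ k → g (d ℕ.* k))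
    multiples zero = trans (sumTo-≡ g (ℕ.*-zeroʳ d)) (reflexive (≡.cong g (≡.sym (ℕ.*-zeroʳ d))))
    multiples (suc m) = begin
      sumTo (d ℕ.* suc m) g                              ≈⟨ sumTo-≡ g d[m+1]≡ ⟩
      sumTo (d ℕ.* m ℕ.+ d′) g + g (suc (d ℕ.* m ℕ.+ d′)) ≈⟨ +-cong (sumTo-pad (d ℕ.* m) d′ g (λ i 0<i i≤d′ → g≈0 m i 0<i (s≤s i≤d′)))
                                                                    (reflexive (≡.cong g (≡.sym d[m+1]≡))) ⟩
      sumTo (d ℕ.* m) g + g (d ℕ.* suc m)                ≈⟨ +-congʳ (multiples m) ⟩
      sumTo (suc m) (λ k → g (d ℕ.* k))                  ∎
      where
      d[m+1]≡ : d ℕ.* suc m ≡ suc (d ℕ.* m ℕ.+ d′)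
      d[m+1]≡ = ≡.trans (ℕ.*-suc d m) (≡.cong suc (ℕ.+-comm d′ (d ℕ.* m)))

  -- (q;q)_n / (q;q)_(n−m) for m ≤ n, and 0 for m > n (the factor i = n is 1 − q⁰), so the
  -- truncated n ∸ i only ever occurs after a zero factor.
  falling : Carrier → ℕ → ℕ → Carrier
  falling q n zero = 1#
  falling q n (suc m) = falling q n m * (1# - q ^ (n ℕ.∸ m))

  falling-≡ : ∀ q n {m m′} → m ≡ m′ → falling q n m ≈ falling q n m′
  falling-≡ q n ≡.refl = refl

  falling-≈0 : ∀ q {n m} → n ℕ.< m → falling q n m ≈ 0#
  falling-≈0 q {n} {suc m} (s≤s n≤m) with ℕ.m≤n⇒m<n∨m≡n n≤m
  ... | inj₁ n<m = *-≈0ˡ _ (falling-≈0 q n<m)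
  ... | inj₂ ≡.refl = *-≈0ʳ _ (trans (+-congˡ (-‿cong (^-≡ q (ℕ.n∸n≡0 n)))) (-‿inverseʳ 1#))

  falling-suc : ∀ q n m → falling q (suc n) (suc m) ≈ (1# - q ^ suc n) * falling q n m
  falling-suc q n zero = trans (*-identityˡ _) (sym (*-identityʳ _))
  falling-suc q n (suc m) = trans (*-congʳ (falling-suc q n m)) (*-assoc _ _ _)

  falling-poch : ∀ q n m → m ℕ.≤ n → falling q n m * poch q q (n ℕ.∸ m) ≈ poch q q n
  falling-poch q n zero _ = *-identityˡ _
  falling-poch q n (suc m) m<n = begin
    (falling q n m * (1# - q ^ (n ℕ.∸ m))) * poch q q (n ℕ.∸ suc m)  ≈⟨ *-assoc _ _ _ ⟩
    falling q n m * ((1# - q ^ (n ℕ.∸ m)) * poch q q (n ℕ.∸ suc m))  ≈⟨ *-congˡ (trans (*-comm _ _) (sym peel)) ⟩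
    falling q n m * poch q q (n ℕ.∸ m)                                ≈⟨ falling-poch q n m (ℕ.<⇒≤ m<n) ⟩
    poch q q n                                                         ∎
    where
    n∸m≡ : n ℕ.∸ m ≡ suc (n ℕ.∸ suc m)
    n∸m≡ = ℕ.+-∸-assoc 1 m<n
    peel : poch q q (n ℕ.∸ m) ≈ poch q q (n ℕ.∸ suc m) * (1# - q ^ (n ℕ.∸ m))
    peel = trans (poch-≡ q q n∸m≡) (*-congˡ (+-congˡ (-‿cong (^-≡ q (≡.sym n∸m≡)))))

  falling-three : ∀ q k m → falling q (k ℕ.+ m) (3 ℕ.+ k) * q ^ 3
                            ≈ falling q (k ℕ.+ m) k * (((1# - q ^ m) * (q - q ^ m)) * (q * q - q ^ m))
  falling-three q k m = trans (*-congʳ (*-cong (*-cong (*-congˡ (factor 0)) (factor 1)) (factor 2))) (by-cases m)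
    where
    prefix : Carrier
    prefix = falling q (k ℕ.+ m) k
    factor : ∀ i → 1# - q ^ ((k ℕ.+ m) ℕ.∸ (i ℕ.+ k)) ≈ 1# - q ^ (m ℕ.∸ i)
    factor i = +-congˡ (-‿cong (^-≡ q (≡.trans (≡.cong ((k ℕ.+ m) ℕ.∸_) (ℕ.+-comm i k)) (ℕ.[m+n]∸[m+o]≡n∸o k m i))))
    by-cases : ∀ m → prefix * (1# - q ^ (m ℕ.∸ 0)) * (1# - q ^ (m ℕ.∸ 1)) * (1# - q ^ (m ℕ.∸ 2)) * q ^ 3
                     ≈ prefix * (((1# - q ^ m) * (q - q ^ m)) * (q * q - q ^ m))
    by-cases zero = solve 2 (λ F q → (((F :* (𝟙 :- 𝟙)) :* (𝟙 :- 𝟙)) :* (𝟙 :- 𝟙)) :* (q :* (q :* (q :* 𝟙)))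
                                      := F :* (((𝟙 :- 𝟙) :* (q :- 𝟙)) :* ((q :* q) :- 𝟙))) refl prefix q
    by-cases (suc zero) = solve 2 (λ F q → (((F :* (𝟙 :- q :* 𝟙)) :* (𝟙 :- 𝟙)) :* (𝟙 :- 𝟙)) :* (q :* (q :* (q :* 𝟙)))
                                      := F :* (((𝟙 :- q :* 𝟙) :* (q :- q :* 𝟙)) :* ((q :* q) :- q :* 𝟙))) refl prefix q
    by-cases (suc (suc m)) = solve 3 (λ F q U → (((F :* (𝟙 :- q :* (q :* U))) :* (𝟙 :- q :* U)) :* (𝟙 :- U)) :* (q :* (q :* (q :* 𝟙)))
                                      := F :* (((𝟙 :- q :* (q :* U)) :* (q :- q :* (q :* U))) :* ((q :* q) :- q :* (q :* U)))) refl prefix q (q ^ m)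

  -- c^m (v/c; p)_m with the division cleared.
  homogeneousPoch : Carrier → Carrier → Carrier → ℕ → Carrier
  homogeneousPoch c v p zero = 1#
  homogeneousPoch c v p (suc m) = homogeneousPoch c v p m * (c - v * p ^ m)

  homogeneousPoch-cong : ∀ c {v v′} p m → v ≈ v′ → homogeneousPoch c v p m ≈ homogeneousPoch c v′ p m
  homogeneousPoch-cong c p zero v≈v′ = refl
  homogeneousPoch-cong c p (suc m) v≈v′ = *-cong (homogeneousPoch-cong c p m v≈v′) (+-congˡ (-‿cong (*-congʳ v≈v′)))

  poch-*-^ : ∀ u p c m → poch u p m * c ^ m ≈ homogeneousPoch c (u * c) p m
  poch-*-^ u p c zero = *-identityʳ _
  poch-*-^ u p c (suc m) = begin
    poch u p m * (1# - u * p ^ m) * (c * c ^ m)          ≈⟨ *-solve 4 (λ a b c d → (a ⊕ b) ⊕ (c ⊕ d) ⊜ (a ⊕ d) ⊕ (b ⊕ c)) refl _ _ _ _ ⟩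
    poch u p m * c ^ m * ((1# - u * p ^ m) * c)
      ≈⟨ *-cong (poch-*-^ u p c m) (solve 3 (λ u P c → (𝟙 :- u :* P) :* c := c :- u :* c :* P) refl u (p ^ m) c) ⟩
    homogeneousPoch c (u * c) p m * (c - u * c * p ^ m)   ∎

  -- Both sides equal (a;p)_(N+1)(aP;P)_m / (1 − a) = (a;P)_(m+1)(ap;p)_N / (1 − a).
  poch-swap : ∀ a p P m N → P ^ m ≈ p ^ N → a * P ^ m ≉ 1# →
              poch a P m * poch (a * p) p N ≈ poch a p N * poch (a * P) P m
  poch-swap a p P m N Pᵐ≈pᴺ aPᵐ≉1 = *-cancelʳ (1-x≉0 aPᵐ≉1) (begin
    poch a P m * poch (a * p) p N * (1# - a * P ^ m)   ≈⟨ *-solve 3 (λ x y z → (x ⊕ y) ⊕ z ⊜ (x ⊕ z) ⊕ y) refl _ _ _ ⟩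
    poch a P m * (1# - a * P ^ m) * poch (a * p) p N   ≈⟨ *-congʳ (poch-shift a P m) ⟩
    (1# - a) * poch (a * P) P m * poch (a * p) p N     ≈⟨ *-solve 3 (λ x y z → (x ⊕ y) ⊕ z ⊜ (x ⊕ z) ⊕ y) refl _ _ _ ⟩
    (1# - a) * poch (a * p) p N * poch (a * P) P m     ≈⟨ *-congʳ (sym (poch-shift a p N)) ⟩
    poch a p N * (1# - a * p ^ N) * poch (a * P) P m   ≈⟨ *-congʳ (*-congˡ (+-congˡ (-‿cong (*-congˡ (sym Pᵐ≈pᴺ))))) ⟩
    poch a p N * (1# - a * P ^ m) * poch (a * P) P m   ≈⟨ *-solve 3 (λ x y z → (x ⊕ y) ⊕ z ⊜ (x ⊕ z) ⊕ y) refl _ _ _ ⟩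
    poch a p N * poch (a * P) P m * (1# - a * P ^ m)   ∎)

  module KeyIdentity (b q : Carrier) (q≉0 : q ≉ 0#)
    (q³ⁱ⁺³≉1 : ∀ i → q ^ 3 * (q ^ 3) ^ i ≉ 1#)
    (bq³ⁱ⁺³≉1 : ∀ i → (b * q ^ 3) * (q ^ 3) ^ i ≉ 1#) where

    summand : ℕ → ℕ → Carrier
    summand n j = b ^ j * q ^ (3 ℕ.* (j ℕ.* j)) * poch b (q ^ 3) (n ℕ.∸ j) * falling q n (3 ℕ.* j)

    denominator : ℕ → Carrier
    denominator j = poch (q ^ 3) (q ^ 3) j * poch (b * q ^ 3) (q ^ 3) j

    keySum : ℕ → Carrier
    keySum n = sumTo n (λ j → summand n j ÷ denominator j)

    denominator-≉0 : ∀ j → denominator j ≉ 0#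
    denominator-≉0 j = *-≉0 (poch-≉0 j (λ i _ → q³ⁱ⁺³≉1 i)) (poch-≉0 j (λ i _ → bq³ⁱ⁺³≉1 i))

    recurrenceˡ recurrenceʳ : ℕ → Carrier
    recurrenceˡ n = 1# - b * q ^ suc n
    recurrenceʳ n = (1# - b * (q ^ n * q ^ n)) * (1# - b * (q * (q ^ n * q ^ n)))

    certificateNumerator : ℕ → ℕ → Carrier
    certificateNumerator n i = q ^ suc n * b ^ suc i * q ^ (3 ℕ.* (i ℕ.* i) ℕ.+ 3 ℕ.* i)
                               * poch b (q ^ 3) (n ℕ.∸ i) * falling q n (2 ℕ.+ 3 ℕ.* i)

    certificate : ℕ → ℕ → Carrier
    certificate n zero = 0#
    certificate n (suc i) = (- certificateNumerator n i) ÷ denominator i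

    ratio : ℕ → Carrier
    ratio i = (1# - q ^ 3 * (q ^ 3) ^ i) * (1# - (b * q ^ 3) * (q ^ 3) ^ i)

    denominator-suc : ∀ i → denominator (suc i) ≈ denominator i * ratio i
    denominator-suc i = *-interchange _ _ _ _

    -- wz-step at j = i + 1 with the common factor b^(i+1) q^(3i²+3i) (b;q³)_(n−i−1) falling q n (3i+2)
    -- cancelled, where n = 3i + 2 + m, X = q^(3i) and U = q^m.
    certificate-identity : ∀ b q X U →
      (1# - b * (q * (q * (q * (X * U))))) * (1# - b * (X * (X * (q ^ 3 * U ^ 3)))) * (1# - q * (q * (q * (X * U))))
        - (1# - b * (q * (q * (X * U)) * (q * (q * (X * U))))) * (1# - b * (q * (q * (q * (X * U)) * (q * (q * (X * U)))))) * (1# - U)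
      ≈ U * ((1# - b * (X * (X * (q ^ 3 * U ^ 3)))) * (1# - q ^ 3 * X) * (1# - b * q ^ 3 * X)
             - b * (q ^ 3 * (X * X)) * ((1# - U) * (q - U) * (q * q - U)))
    certificate-identity = solve 4 (λ b q X U →
      let q³ = q :* (q :* (q :* 𝟙)); U³ = U :* (U :* (U :* 𝟙)); qⁿ = q :* (q :* (X :* U)) in
      (𝟙 :- b :* (q :* qⁿ)) :* (𝟙 :- b :* (X :* (X :* (q³ :* U³)))) :* (𝟙 :- q :* qⁿ)
        :- (𝟙 :- b :* (qⁿ :* qⁿ)) :* (𝟙 :- b :* (q :* (qⁿ :* qⁿ))) :* (𝟙 :- U)
      := U :* ((𝟙 :- b :* (X :* (X :* (q³ :* U³)))) :* (𝟙 :- q³ :* X) :* (𝟙 :- b :* q³ :* X)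
               :- b :* (q³ :* (X :* X)) :* ((𝟙 :- U) :* (q :- U) :* (q :* q :- U)))) refl

    private
      three-squares : ∀ i → 3 ℕ.* (suc i ℕ.* suc i) ≡ (3 ℕ.* (i ℕ.* i) ℕ.+ 3 ℕ.* i) ℕ.+ (3 ℕ.* i ℕ.+ 3)
      three-squares = solve-∀
      three-squares′ : ∀ i → 3 ℕ.* (suc i ℕ.* suc i) ℕ.+ 3 ℕ.* suc i
                            ≡ (3 ℕ.* (i ℕ.* i) ℕ.+ 3 ℕ.* i) ℕ.+ (3 ℕ.* i ℕ.+ (3 ℕ.* i ℕ.+ 6))
      three-squares′ = solve-∀
      split-top : ∀ i m → 2 ℕ.+ 3 ℕ.* i ℕ.+ m ≡ (i ℕ.+ (i ℕ.+ suc m)) ℕ.+ suc i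
      split-top = solve-∀

      module AboveSupport (i m : ℕ) where
        n : ℕ
        n = 2 ℕ.+ 3 ℕ.* i ℕ.+ m
        X U qⁿ bs qE pb F₂ G : Carrier
        X = q ^ (3 ℕ.* i)
        U = q ^ m
        qⁿ = q * (q * (X * U))
        bs = b ^ suc i
        qE = q ^ (3 ℕ.* (i ℕ.* i) ℕ.+ 3 ℕ.* i)
        pb = poch b (q ^ 3) (n ℕ.∸ suc i)
        F₂ = falling q n (2 ℕ.+ 3 ℕ.* i)
        G = 1# - b * (X * (X * (q ^ 3 * U ^ 3)))
        i<n : i ℕ.< n
        i<n = s≤s (ℕ.m≤n⇒m≤1+n (ℕ.≤-trans (ℕ.m≤m+n i (i ℕ.+ (i ℕ.+ 0))) (ℕ.m≤m+n (3 ℕ.* i) m)))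
        qⁿ≈ : q ^ n ≈ qⁿ
        qⁿ≈ = *-congˡ (*-congˡ (^-+ q (3 ℕ.* i) m))
        cA : recurrenceˡ n ≈ 1# - b * (q * qⁿ)
        cA = +-congˡ (-‿cong (*-congˡ (*-congˡ qⁿ≈)))
        cB : recurrenceʳ n ≈ (1# - b * (qⁿ * qⁿ)) * (1# - b * (q * (qⁿ * qⁿ)))
        cB = *-cong (+-congˡ (-‿cong (*-congˡ (*-cong qⁿ≈ qⁿ≈)))) (+-congˡ (-‿cong (*-congˡ (*-congˡ (*-cong qⁿ≈ qⁿ≈)))))
        q³⁽ⁱ⁺¹⁾² : q ^ (3 ℕ.* (suc i ℕ.* suc i)) ≈ qE * (X * q ^ 3)
        q³⁽ⁱ⁺¹⁾² = trans (^-≡ q (three-squares i))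
          (trans (^-+ q (3 ℕ.* (i ℕ.* i) ℕ.+ 3 ℕ.* i) (3 ℕ.* i ℕ.+ 3)) (*-congˡ (^-+ q (3 ℕ.* i) 3)))
        q³⁽ⁱ⁺¹⁾²⁺³⁽ⁱ⁺¹⁾ : q ^ (3 ℕ.* (suc i ℕ.* suc i) ℕ.+ 3 ℕ.* suc i) ≈ qE * (X * (X * (q ^ 3 * q ^ 3)))
        q³⁽ⁱ⁺¹⁾²⁺³⁽ⁱ⁺¹⁾ = trans (^-≡ q (three-squares′ i))
          (trans (^-+ q (3 ℕ.* (i ℕ.* i) ℕ.+ 3 ℕ.* i) (3 ℕ.* i ℕ.+ (3 ℕ.* i ℕ.+ 6)))
          (*-congˡ (trans (^-+ q (3 ℕ.* i) (3 ℕ.* i ℕ.+ 6)) (*-congˡ (trans (^-+ q (3 ℕ.* i) 6) (*-congˡ (^-+ q 3 3)))))))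
        q³ⁿ⁻³ⁱ⁻³ : (q ^ 3) ^ (n ℕ.∸ suc i) ≈ X * (X * (q ^ 3 * U ^ 3))
        q³ⁿ⁻³ⁱ⁻³ = trans (^-≡ (q ^ 3) (≡.trans (≡.cong (ℕ._∸ suc i) (split-top i m)) (ℕ.m+n∸n≡m (i ℕ.+ (i ℕ.+ suc m)) (suc i))))
                   (trans (^-+ (q ^ 3) i (i ℕ.+ suc m))
                   (*-cong (^-^ q 3 i) (trans (^-+ (q ^ 3) i (suc m)) (*-cong (^-^ q 3 i) (*-congˡ (^-*-comm q 3 m))))))
        pochᵇ : poch b (q ^ 3) (n ℕ.∸ i) ≈ pb * G
        pochᵇ = trans (poch-≡ b (q ^ 3) (ℕ.+-∸-assoc 1 i<n)) (*-congˡ (+-congˡ (-‿cong (*-congˡ q³ⁿ⁻³ⁱ⁻³))))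
        summand₁ : summand (suc n) (suc i) ≈ bs * (qE * (X * q ^ 3)) * (pb * G) * ((1# - q * qⁿ) * F₂)
        summand₁ = *-cong (*-cong (*-congˡ q³⁽ⁱ⁺¹⁾²) pochᵇ)
          (trans (falling-≡ q (suc n) (ℕ.*-suc 3 i)) (trans (falling-suc q n (2 ℕ.+ 3 ℕ.* i)) (*-congʳ (+-congˡ (-‿cong (*-congˡ qⁿ≈))))))
        summand₀ : summand n (suc i) ≈ bs * (qE * (X * q ^ 3)) * pb * (F₂ * (1# - U))
        summand₀ = *-cong (*-congʳ (*-congˡ q³⁽ⁱ⁺¹⁾²))
          (trans (falling-≡ q n (ℕ.*-suc 3 i)) (*-congˡ (+-congˡ (-‿cong (^-≡ q (ℕ.m+n∸m≡n (2 ℕ.+ 3 ℕ.* i) m))))))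
        certificateNumerator₁ : certificateNumerator n (suc i) * q ^ 3
          ≈ q * qⁿ * (b * bs) * (qE * (X * (X * (q ^ 3 * q ^ 3)))) * pb * (F₂ * ((1# - U) * (q - U) * (q * q - U)))
        certificateNumerator₁ = trans (*-assoc _ _ _) (*-cong (*-congʳ (*-cong (*-congʳ (*-congˡ qⁿ≈)) q³⁽ⁱ⁺¹⁾²⁺³⁽ⁱ⁺¹⁾))
          (trans (*-congʳ (falling-≡ q n (≡.cong (2 ℕ.+_) (ℕ.*-suc 3 i)))) (falling-three q (2 ℕ.+ 3 ℕ.* i) m)))
        certificateNumerator₀ : certificateNumerator n i ≈ q * qⁿ * bs * qE * (pb * G) * F₂
        certificateNumerator₀ = *-congʳ (*-cong (*-congʳ (*-congʳ (*-congˡ qⁿ≈))) pochᵇ)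
        ratio≈ : ratio i ≈ (1# - q ^ 3 * X) * (1# - b * q ^ 3 * X)
        ratio≈ = *-cong (+-congˡ (-‿cong (*-congˡ (^-^ q 3 i)))) (+-congˡ (-‿cong (*-congˡ (^-^ q 3 i))))

    numerator-identity-≥ : ∀ i m → let n = 2 ℕ.+ 3 ℕ.* i ℕ.+ m in
      recurrenceˡ n * summand (suc n) (suc i) - recurrenceʳ n * summand n (suc i)
        ≈ - certificateNumerator n (suc i) + certificateNumerator n i * ratio i
    numerator-identity-≥ i m = *-cancelʳ (^-≉0 3 q≉0) (begin
      (recurrenceˡ n * summand (suc n) (suc i) - recurrenceʳ n * summand n (suc i)) * q ^ 3
        ≈⟨ *-congʳ (+-cong (*-cong cA summand₁) (-‿cong (*-cong cB summand₀))) ⟩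
      ((1# - b * (q * qⁿ)) * (bs * (qE * (X * q ^ 3)) * (pb * G) * ((1# - q * qⁿ) * F₂))
        - (1# - b * (qⁿ * qⁿ)) * (1# - b * (q * (qⁿ * qⁿ))) * (bs * (qE * (X * q ^ 3)) * pb * (F₂ * (1# - U)))) * q ^ 3
        ≈⟨ solve 8 (λ b q X U bs qE pb F₂ →
             let q³ = q :* (q :* (q :* 𝟙)); U³ = U :* (U :* (U :* 𝟙)); qⁿ = q :* (q :* (X :* U))
                 G = 𝟙 :- b :* (X :* (X :* (q³ :* U³))) in
             ((𝟙 :- b :* (q :* qⁿ)) :* (bs :* (qE :* (X :* q³)) :* (pb :* G) :* ((𝟙 :- q :* qⁿ) :* F₂))
               :- (𝟙 :- b :* (qⁿ :* qⁿ)) :* (𝟙 :- b :* (q :* (qⁿ :* qⁿ))) :* (bs :* (qE :* (X :* q³)) :* pb :* (F₂ :* (𝟙 :- U)))) :* q³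
             := bs :* qE :* pb :* F₂ :* (X :* (q³ :* q³)) :*
                ((𝟙 :- b :* (q :* qⁿ)) :* G :* (𝟙 :- q :* qⁿ) :- (𝟙 :- b :* (qⁿ :* qⁿ)) :* (𝟙 :- b :* (q :* (qⁿ :* qⁿ))) :* (𝟙 :- U)))
           refl b q X U bs qE pb F₂ ⟩
      bs * qE * pb * F₂ * (X * (q ^ 3 * q ^ 3)) *
        ((1# - b * (q * qⁿ)) * G * (1# - q * qⁿ) - (1# - b * (qⁿ * qⁿ)) * (1# - b * (q * (qⁿ * qⁿ))) * (1# - U))
        ≈⟨ *-congˡ (certificate-identity b q X U) ⟩
      bs * qE * pb * F₂ * (X * (q ^ 3 * q ^ 3)) *
        (U * (G * (1# - q ^ 3 * X) * (1# - b * q ^ 3 * X) - b * (q ^ 3 * (X * X)) * ((1# - U) * (q - U) * (q * q - U))))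
        ≈⟨ solve 8 (λ b q X U bs qE pb F₂ →
             let q³ = q :* (q :* (q :* 𝟙)); U³ = U :* (U :* (U :* 𝟙)); qⁿ = q :* (q :* (X :* U))
                 G = 𝟙 :- b :* (X :* (X :* (q³ :* U³))) in
             bs :* qE :* pb :* F₂ :* (X :* (q³ :* q³)) :*
               (U :* (G :* (𝟙 :- q³ :* X) :* (𝟙 :- b :* q³ :* X) :- b :* (q³ :* (X :* X)) :* ((𝟙 :- U) :* (q :- U) :* (q :* q :- U))))
             := :- (q :* qⁿ :* (b :* bs) :* (qE :* (X :* (X :* (q³ :* q³)))) :* pb :* (F₂ :* ((𝟙 :- U) :* (q :- U) :* (q :* q :- U))))
                :+ q :* qⁿ :* bs :* qE :* (pb :* G) :* F₂ :* ((𝟙 :- q³ :* X) :* (𝟙 :- b :* q³ :* X)) :* q³)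
           refl b q X U bs qE pb F₂ ⟩
      - (q * qⁿ * (b * bs) * (qE * (X * (X * (q ^ 3 * q ^ 3)))) * pb * (F₂ * ((1# - U) * (q - U) * (q * q - U))))
        + q * qⁿ * bs * qE * (pb * G) * F₂ * ((1# - q ^ 3 * X) * (1# - b * q ^ 3 * X)) * q ^ 3
        ≈⟨ +-cong (-‿cong (sym certificateNumerator₁)) (*-congʳ (*-cong (sym certificateNumerator₀) (sym ratio≈))) ⟩
      - (certificateNumerator n (suc i) * q ^ 3) + certificateNumerator n i * ratio i * q ^ 3
        ≈⟨ solve 3 (λ y z p → :- (y :* p) :+ z :* p := (:- y :+ z) :* p) refl _ _ _ ⟩
      (- certificateNumerator n (suc i) + certificateNumerator n i * ratio i) * q ^ 3 ∎)
      where open AboveSupport i m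

    numerator-identity : ∀ n i →
      recurrenceˡ n * summand (suc n) (suc i) - recurrenceʳ n * summand n (suc i)
        ≈ - certificateNumerator n (suc i) + certificateNumerator n i * ratio i
    numerator-identity n i with n ℕ.<? 2 ℕ.+ 3 ℕ.* i
    ... | no n≮ with ℕ.m≤n⇒∃[o]m+o≡n (ℕ.≮⇒≥ n≮)
    ...   | m , ≡.refl = numerator-identity-≥ i m
    numerator-identity n i | yes n<2+3i = begin
      recurrenceˡ n * summand (suc n) (suc i) - recurrenceʳ n * summand n (suc i)
        ≈⟨ +-cong (*-congˡ (*-≈0ʳ _ (falling-≈0 q (ℕ.≤-trans (s≤s n<2+3i) 3+3i≤)))) (-‿cong (*-congˡ (*-≈0ʳ _ (falling-≈0 q n<3+3i)))) ⟩
      recurrenceˡ n * 0# - recurrenceʳ n * 0#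
        ≈⟨ solve 3 (λ a c e → a :* con (0 , 0) :- c :* con (0 , 0) := :- con (0 , 0) :+ con (0 , 0) :* e) refl _ _ (ratio i) ⟩
      - 0# + 0# * ratio i
        ≈⟨ sym (+-cong (-‿cong (*-≈0ʳ _ (falling-≈0 q (ℕ.≤-trans n<3+3i (ℕ.m≤n+m _ 2))))) (*-congʳ (*-≈0ʳ _ (falling-≈0 q n<2+3i)))) ⟩
      - certificateNumerator n (suc i) + certificateNumerator n i * ratio i ∎
      where
      3+3i≤ : 3 ℕ.+ 3 ℕ.* i ℕ.≤ 3 ℕ.* suc i
      3+3i≤ = ℕ.≤-reflexive (≡.sym (ℕ.*-suc 3 i))
      n<3+3i : n ℕ.< 3 ℕ.* suc i
      n<3+3i = ℕ.≤-trans (ℕ.m≤n⇒m≤1+n n<2+3i) 3+3i≤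

    numerator-identity₀ : ∀ n → recurrenceˡ n * summand (suc n) 0 - recurrenceʳ n * summand n 0 ≈ - certificateNumerator n 0
    numerator-identity₀ zero = solve 2 (λ b q →
      (𝟙 :- b :* (q :* 𝟙)) :* (𝟙 :* 𝟙 :* (𝟙 :* (𝟙 :- b :* 𝟙)) :* 𝟙)
        :- (𝟙 :- b :* (𝟙 :* 𝟙)) :* (𝟙 :- b :* (q :* (𝟙 :* 𝟙))) :* (𝟙 :* 𝟙 :* 𝟙 :* 𝟙)
      := :- (q :* 𝟙 :* (b :* 𝟙) :* 𝟙 :* 𝟙 :* (𝟙 :* (𝟙 :- 𝟙) :* (𝟙 :- 𝟙)))) refl b q
    numerator-identity₀ (suc m) =
      trans (+-congʳ (*-congˡ (*-congʳ (*-congˡ (*-congˡ (+-congˡ (-‿cong (*-congˡ (*-congˡ (^-*-comm q 3 m))))))))))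
      (solve 4 (λ b q Y P →
        let Y³ = Y :* (Y :* (Y :* 𝟙)); q³ = q :* (q :* (q :* 𝟙)) in
        (𝟙 :- b :* (q :* (q :* Y))) :* (𝟙 :* 𝟙 :* (P :* (𝟙 :- b :* (q³ :* Y³))) :* 𝟙)
          :- (𝟙 :- b :* (q :* Y :* (q :* Y))) :* (𝟙 :- b :* (q :* (q :* Y :* (q :* Y)))) :* (𝟙 :* 𝟙 :* P :* 𝟙)
        := :- (q :* (q :* Y) :* (b :* 𝟙) :* 𝟙 :* P :* (𝟙 :* (𝟙 :- q :* Y) :* (𝟙 :- Y)))) refl b q (q ^ m) (poch b (q ^ 3) (suc m)))

    private
      factor-out : ∀ x u y v w → x * (u * w) - y * (v * w) ≈ (x * u - y * v) * w
      factor-out = solve 5 (λ x u y v w → x :* (u :* w) :- y :* (v :* w) := (x :* u :- y :* v) :* w) refl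

    wz-step : ∀ n j → recurrenceˡ n * (summand (suc n) j ÷ denominator j) - recurrenceʳ n * (summand n j ÷ denominator j)
                      ≈ certificate n (suc j) - certificate n j
    wz-step n zero = begin
      recurrenceˡ n * (summand (suc n) 0 ÷ denominator 0) - recurrenceʳ n * (summand n 0 ÷ denominator 0)
        ≈⟨ factor-out _ _ _ _ _ ⟩
      (recurrenceˡ n * summand (suc n) 0 - recurrenceʳ n * summand n 0) ÷ denominator 0
        ≈⟨ *-congʳ (numerator-identity₀ n) ⟩
      (- certificateNumerator n 0) ÷ denominator 0
        ≈⟨ solve 2 (λ y w → y :* w := y :* w :- con (0 , 0)) refl _ _ ⟩
      certificate n 1 - certificate n 0 ∎
    wz-step n (suc i) = begin
      recurrenceˡ n * (summand (suc n) (suc i) ÷ denominator (suc i)) - recurrenceʳ n * (summand n (suc i) ÷ denominator (suc i))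
        ≈⟨ factor-out _ _ _ _ _ ⟩
      (recurrenceˡ n * summand (suc n) (suc i) - recurrenceʳ n * summand n (suc i)) ÷ denominator (suc i)
        ≈⟨ *-congʳ (numerator-identity n i) ⟩
      (- certificateNumerator n (suc i) + certificateNumerator n i * ratio i) ÷ denominator (suc i)
        ≈⟨ solve 4 (λ y₁ y₀ e w → (:- y₁ :+ y₀ :* e) :* w := :- y₁ :* w :- :- y₀ :* (e :* w)) refl _ _ _ _ ⟩
      (- certificateNumerator n (suc i)) ÷ denominator (suc i) - (- certificateNumerator n i) * (ratio i ÷ denominator (suc i))
        ≈⟨ +-congˡ (-‿cong (*-congˡ ratio÷denominator)) ⟩
      certificate n (suc (suc i)) - certificate n (suc i) ∎
      where
      ratio÷denominator : ratio i ÷ denominator (suc i) ≈ denominator i ⁻¹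
      ratio÷denominator = ÷-intro (denominator-≉0 (suc i)) (sym (begin
        denominator i ⁻¹ * denominator (suc i)          ≈⟨ *-congˡ (denominator-suc i) ⟩
        denominator i ⁻¹ * (denominator i * ratio i)    ≈⟨ sym (*-assoc _ _ _) ⟩
        denominator i ⁻¹ * denominator i * ratio i      ≈⟨ *-congʳ (⁻¹-inverseˡ _ (denominator-≉0 i)) ⟩
        1# * ratio i                                    ≈⟨ *-identityˡ _ ⟩
        ratio i                                         ∎))

    recurrence : ∀ n → recurrenceˡ n * keySum (suc n) ≈ recurrenceʳ n * keySum n
    recurrence n = x∙y⁻¹≈ε⇒x≈y _ _ (begin
      recurrenceˡ n * keySum (suc n) - recurrenceʳ n * keySum n
        ≈⟨ +-congˡ (-‿cong (*-congˡ (sym keySum-extend))) ⟩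
      recurrenceˡ n * keySum (suc n) - recurrenceʳ n * sumTo (suc n) (term n)
        ≈⟨ +-cong (*-distribˡ-sumTo _ (suc n) _) (-‿cong (*-distribˡ-sumTo _ (suc n) _)) ⟩
      sumTo (suc n) (λ j → recurrenceˡ n * term (suc n) j) - sumTo (suc n) (λ j → recurrenceʳ n * term n j)
        ≈⟨ sym (sumTo-- (suc n) _ _) ⟩
      sumTo (suc n) (λ j → recurrenceˡ n * term (suc n) j - recurrenceʳ n * term n j)
        ≈⟨ sumTo-cong (suc n) (λ j _ → wz-step n j) ⟩
      sumTo (suc n) (λ j → certificate n (suc j) - certificate n j)
        ≈⟨ sumTo-telescope (suc n) (certificate n) ⟩
      certificate n (suc (suc n)) - 0#
        ≈⟨ +-congʳ (*-≈0ˡ _ (trans (-‿cong (*-≈0ʳ _ (falling-≈0 q n<2+3[n+1]))) ε⁻¹≈ε)) ⟩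
      0# - 0#
        ≈⟨ -‿inverseʳ 0# ⟩
      0# ∎)
      where
      term : ℕ → ℕ → Carrier
      term n j = summand n j ÷ denominator j
      n<3[n+1] : n ℕ.< 3 ℕ.* suc n
      n<3[n+1] = s≤s (ℕ.m≤m+n n (2 ℕ.* suc n))
      n<2+3[n+1] : n ℕ.< 2 ℕ.+ 3 ℕ.* suc n
      n<2+3[n+1] = ℕ.≤-trans n<3[n+1] (ℕ.m≤n+m _ 2)
      keySum-extend : sumTo (suc n) (term n) ≈ keySum n
      keySum-extend = trans (+-congˡ (*-≈0ˡ _ (*-≈0ʳ _ (falling-≈0 q n<3[n+1])))) (+-identityʳ _)

    key-identity : ∀ n → keySum n * poch (b * q) q n ≈ poch b q (2 ℕ.* n)
    key-identity zero = trans (*-identityʳ _) (÷-intro (*-≉0 1≉0 1≉0) (solve 0 (𝟙 :* 𝟙 :* 𝟙 :* 𝟙 := 𝟙 :* (𝟙 :* 𝟙)) refl))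
    key-identity (suc n) = begin
      keySum (suc n) * (poch (b * q) q n * (1# - b * q * q ^ n))
        ≈⟨ solve 5 (λ v p b q Q → v :* (p :* (𝟙 :- b :* q :* Q)) := (𝟙 :- b :* (q :* Q)) :* v :* p) refl _ _ b q (q ^ n) ⟩
      recurrenceˡ n * keySum (suc n) * poch (b * q) q n
        ≈⟨ *-congʳ (recurrence n) ⟩
      recurrenceʳ n * keySum n * poch (b * q) q n
        ≈⟨ *-assoc _ _ _ ⟩
      recurrenceʳ n * (keySum n * poch (b * q) q n)
        ≈⟨ *-congˡ (key-identity n) ⟩
      recurrenceʳ n * poch b q (2 ℕ.* n)
        ≈⟨ solve 4 (λ p b q Q → (𝟙 :- b :* (Q :* Q)) :* (𝟙 :- b :* (q :* (Q :* Q))) :* p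
                                := p :* (𝟙 :- b :* (Q :* Q)) :* (𝟙 :- b :* (q :* (Q :* Q)))) refl _ b q (q ^ n) ⟩
      poch b q (2 ℕ.* n) * (1# - b * (q ^ n * q ^ n)) * (1# - b * (q * (q ^ n * q ^ n)))
        ≈⟨ sym (*-cong (*-congˡ (+-congˡ (-‿cong (*-congˡ q²ⁿ)))) (+-congˡ (-‿cong (*-congˡ (*-congˡ q²ⁿ))))) ⟩
      poch b q (2 ℕ.+ 2 ℕ.* n)
        ≈⟨ poch-≡ b q (≡.sym (ℕ.*-suc 2 n)) ⟩
      poch b q (2 ℕ.* suc n) ∎
      where
      q²ⁿ : q ^ (2 ℕ.* n) ≈ q ^ n * q ^ n
      q²ⁿ = trans (^-+ q n (n ℕ.+ 0)) (*-congˡ (^-≡ q (ℕ.+-identityʳ n)))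

  module _ (a q : Carrier) (a≉0 : a ≉ 0#) (q≉0 : q ≉ 0#)
    (qⁿ⁺¹≉1 : ∀ n → q ^ suc n ≉ 1#) (aqᵐ≉1 : ∀ m → a * q ^ m ≉ 1#) where

    module Reflection (L : ℕ) where

      W Z : Carrier
      W = q ^ L
      Z = q ^ (3 ℕ.* L)

      -- The two sides of reflection multiplied by W^(3r) (aZ)^r, which clears every inverse.
      reflectionˡ : ℕ → ℕ → Carrier
      reflectionˡ r s = homogeneousPoch W 1# q (3 ℕ.* r) * q ^ (3 ℕ.* r) * poch q q s * poch a (q ^ 3) L * (a * Z) ^ r

      reflectionʳ : ℕ → Carrier
      reflectionʳ r = a ^ r * q ^ (3 ℕ.* (r ℕ.* r)) * poch q q L * poch a (q ^ 3) (L ℕ.∸ r)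
                      * homogeneousPoch (a * Z) (q ^ 3) (q ^ 3) r * W ^ (3 ℕ.* r)

      -- The step r ↦ r + 1 with L = 3r + 3 + s, X = q^(3r), S = q^s: three new factors of
      -- (q^(−L);q)_(3r) are matched against one new factor of (q^(3−3L)/a;q³)_r.
      reflection-step-identity : ∀ X q S a → let W = X * (q * (q * (q * S))) in
        (W - 1# * X) * (W - 1# * (q * X)) * (W - 1# * (q * (q * X)))
          * (q ^ 3 * (a * W ^ 3 * (1# - a * (X * (X * (q ^ 3 * (q ^ 3 * S ^ 3)))))))
        ≈ a * (X * (X * q ^ 3)) * ((a * W ^ 3 - q ^ 3 * X) * W ^ 3)
          * ((1# - q * S) * (1# - q * (q * S)) * (1# - q * (q * (q * S))))
      reflection-step-identity = solve 4 (λ X q S a →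
        let q³ = q :* (q :* (q :* 𝟙)); S³ = S :* (S :* (S :* 𝟙)); W = X :* (q :* (q :* (q :* S)))
            W³ = W :* (W :* (W :* 𝟙)) in
        (W :- 𝟙 :* X) :* (W :- 𝟙 :* (q :* X)) :* (W :- 𝟙 :* (q :* (q :* X)))
          :* (q³ :* (a :* W³ :* (𝟙 :- a :* (X :* (X :* (q³ :* (q³ :* S³)))))))
        := a :* (X :* (X :* q³)) :* ((a :* W³ :- q³ :* X) :* W³)
          :* ((𝟙 :- q :* S) :* (𝟙 :- q :* (q :* S)) :* (𝟙 :- q :* (q :* (q :* S))))) refl

      a[q³]ᵏ≉1 : ∀ k → a * (q ^ 3) ^ k ≉ 1#
      a[q³]ᵏ≉1 k a[q³]ᵏ≈1 = aqᵐ≉1 (3 ℕ.* k) (trans (*-congˡ (sym (^-^ q 3 k))) a[q³]ᵏ≈1)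

      private
        3[r+1]+s : ∀ r s → 3 ℕ.* suc r ℕ.+ s ≡ 3 ℕ.* r ℕ.+ (3 ℕ.+ s)
        3[r+1]+s = solve-∀
        3[r+1]+s-as-sum : ∀ r s → 3 ℕ.* suc r ℕ.+ s ≡ (r ℕ.+ (r ℕ.+ suc (suc s))) ℕ.+ suc r
        3[r+1]+s-as-sum = solve-∀
        3[r+1]² : ∀ r → 3 ℕ.* (suc r ℕ.* suc r) ≡ 3 ℕ.* (r ℕ.* r) ℕ.+ (3 ℕ.* r ℕ.+ (3 ℕ.* r ℕ.+ 3))
        3[r+1]² = solve-∀

        module InductionStep (r s : ℕ) (L≡ : L ≡ 3 ℕ.* suc r ℕ.+ s) where
          X S G F₃ cubic quartic Wₓ : Carrier
          X = q ^ (3 ℕ.* r)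
          S = q ^ s
          G = 1# - a * (q ^ 3) ^ (L ℕ.∸ suc r)
          F₃ = (1# - q * S) * (1# - q * (q * S)) * (1# - q * (q * (q * S)))
          cubic = (W - 1# * X) * (W - 1# * (q * X)) * (W - 1# * (q * (q * X)))
          quartic = a * (X * (X * q ^ 3)) * ((a * Z - q ^ 3 * X) * W ^ 3)
          Wₓ = X * (q * (q * (q * S)))
          F₃≉0 : F₃ ≉ 0#
          F₃≉0 = *-≉0 (*-≉0 (1-x≉0 (qⁿ⁺¹≉1 s)) (1-x≉0 (qⁿ⁺¹≉1 (suc s)))) (1-x≉0 (qⁿ⁺¹≉1 (suc (suc s))))
          G≉0 : G ≉ 0#
          G≉0 = 1-x≉0 (a[q³]ᵏ≉1 (L ℕ.∸ suc r))
          r<L : r ℕ.< L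
          r<L = ≡.subst (suc r ℕ.≤_) (≡.sym (≡.trans L≡ (3[r+1]+s-as-sum r s))) (ℕ.m≤n+m (suc r) _)
          W≈ : W ≈ Wₓ
          W≈ = trans (^-≡ q (≡.trans L≡ (3[r+1]+s r s))) (^-+ q (3 ℕ.* r) (3 ℕ.+ s))
          Z≈ : Z ≈ W ^ 3
          Z≈ = ^-* q 3 L
          G≈ : G ≈ 1# - a * (X * (X * (q ^ 3 * (q ^ 3 * S ^ 3))))
          G≈ = +-congˡ (-‿cong (*-congˡ (trans (^-≡ (q ^ 3) L∸[r+1]≡)
                 (trans (^-+ (q ^ 3) r (r ℕ.+ suc (suc s))) (*-cong (^-^ q 3 r)
                 (trans (^-+ (q ^ 3) r (suc (suc s))) (*-cong (^-^ q 3 r) (*-congˡ (*-congˡ (^-*-comm q 3 s))))))))))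
            where
            L∸[r+1]≡ : L ℕ.∸ suc r ≡ r ℕ.+ (r ℕ.+ suc (suc s))
            L∸[r+1]≡ = ≡.trans (≡.cong (ℕ._∸ suc r) (≡.trans L≡ (3[r+1]+s-as-sum r s))) (ℕ.m+n∸n≡m _ (suc r))
          step : cubic * (q ^ 3 * (a * Z)) * G ≈ quartic * F₃
          step = begin
            cubic * (q ^ 3 * (a * Z)) * G
              ≈⟨ trans (*-assoc _ _ _) (*-congˡ (*-assoc _ _ _)) ⟩
            cubic * (q ^ 3 * (a * Z * G))
              ≈⟨ *-cong (*-cong (*-cong (+-congʳ W≈) (+-congʳ W≈)) (+-congʳ W≈))
                        (*-congˡ (*-cong (*-congˡ (trans Z≈ (^-cong 3 W≈))) G≈)) ⟩
            (Wₓ - 1# * X) * (Wₓ - 1# * (q * X)) * (Wₓ - 1# * (q * (q * X)))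
              * (q ^ 3 * (a * Wₓ ^ 3 * (1# - a * (X * (X * (q ^ 3 * (q ^ 3 * S ^ 3)))))))
              ≈⟨ reflection-step-identity X q S a ⟩
            a * (X * (X * q ^ 3)) * ((a * Wₓ ^ 3 - q ^ 3 * X) * Wₓ ^ 3) * F₃
              ≈⟨ sym (*-congʳ (*-congˡ (*-cong (+-congʳ (*-congˡ (trans Z≈ (^-cong 3 W≈)))) (^-cong 3 W≈)))) ⟩
            quartic * F₃ ∎
          unfoldˡ : reflectionˡ (suc r) s * F₃ ≈ reflectionˡ r (3 ℕ.+ s) * (cubic * (q ^ 3 * (a * Z)))
          unfoldˡ = begin
            reflectionˡ (suc r) s * F₃
              ≈⟨ *-congʳ (*-congʳ (*-congʳ (*-congʳ (*-cong (reflexive (≡.cong (homogeneousPoch W 1# q) (ℕ.*-suc 3 r)))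
                                                              (^-≡ q (ℕ.*-suc 3 r)))))) ⟩
            homogeneousPoch W 1# q (3 ℕ.+ 3 ℕ.* r) * q ^ (3 ℕ.+ 3 ℕ.* r) * poch q q s * poch a (q ^ 3) L * (a * Z) ^ suc r * F₃
              ≈⟨ *-solve 13 (λ hP c₁ c₂ c₃ q X pqs f₁ f₂ f₃ aPL aZ aZʳ →
                   (((((((hP ⊕ c₁) ⊕ c₂) ⊕ c₃) ⊕ (q ⊕ (q ⊕ (q ⊕ X)))) ⊕ pqs) ⊕ aPL) ⊕ (aZ ⊕ aZʳ)) ⊕ ((f₁ ⊕ f₂) ⊕ f₃)
                   ⊜ ((((hP ⊕ X) ⊕ (((pqs ⊕ f₁) ⊕ f₂) ⊕ f₃)) ⊕ aPL) ⊕ aZʳ) ⊕ (((c₁ ⊕ c₂) ⊕ c₃) ⊕ ((q ⊕ (q ⊕ (q ⊕ ε))) ⊕ aZ)))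
                 refl _ _ _ _ q X _ _ _ _ _ (a * Z) _ ⟩
            reflectionˡ r (3 ℕ.+ s) * (cubic * (q ^ 3 * (a * Z))) ∎
          unfoldʳ : reflectionʳ r * quartic ≈ reflectionʳ (suc r) * G
          unfoldʳ = begin
            reflectionʳ r * quartic
              ≈⟨ *-congʳ (*-congʳ (*-congʳ (*-congˡ (poch-≡ a (q ^ 3) (ℕ.+-∸-assoc 1 r<L))))) ⟩
            a ^ r * q ^ (3 ℕ.* (r ℕ.* r)) * poch q q L * (poch a (q ^ 3) (L ℕ.∸ suc r) * G)
              * homogeneousPoch (a * Z) (q ^ 3) (q ^ 3) r * W ^ (3 ℕ.* r) * quartic
              ≈⟨ *-solve 12 (λ aʳ qʳʳ pqL aPm G hY Wʳ a X q³ t W →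
                   (((((aʳ ⊕ qʳʳ) ⊕ pqL) ⊕ (aPm ⊕ G)) ⊕ hY) ⊕ Wʳ) ⊕ ((a ⊕ (X ⊕ (X ⊕ q³))) ⊕ (t ⊕ (W ⊕ (W ⊕ (W ⊕ ε)))))
                   ⊜ ((((((a ⊕ aʳ) ⊕ (qʳʳ ⊕ (X ⊕ (X ⊕ q³)))) ⊕ pqL) ⊕ aPm) ⊕ (hY ⊕ t)) ⊕ (W ⊕ (W ⊕ (W ⊕ Wʳ)))) ⊕ G)
                 refl _ _ _ _ G _ _ a X (q ^ 3) (a * Z - q ^ 3 * X) W ⟩
            a * a ^ r * (q ^ (3 ℕ.* (r ℕ.* r)) * (X * (X * q ^ 3))) * poch q q L * poch a (q ^ 3) (L ℕ.∸ suc r)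
              * (homogeneousPoch (a * Z) (q ^ 3) (q ^ 3) r * (a * Z - q ^ 3 * X)) * W ^ (3 ℕ.+ 3 ℕ.* r) * G
              ≈⟨ *-congʳ (*-cong (*-cong (*-congʳ (*-congʳ (*-congˡ (sym q^3[r+1]²))))
                                          (*-congˡ (+-congˡ (-‿cong (*-congˡ (sym (^-^ q 3 r)))))))
                                  (^-≡ W (≡.sym (ℕ.*-suc 3 r)))) ⟩
            reflectionʳ (suc r) * G ∎
            where
            q^3[r+1]² : q ^ (3 ℕ.* (suc r ℕ.* suc r)) ≈ q ^ (3 ℕ.* (r ℕ.* r)) * (X * (X * q ^ 3))
            q^3[r+1]² = trans (^-≡ q (3[r+1]² r)) (trans (^-+ q (3 ℕ.* (r ℕ.* r)) _)
                        (*-congˡ (trans (^-+ q (3 ℕ.* r) _) (*-congˡ (^-+ q (3 ℕ.* r) 3)))))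

      reflection-inverse-free : ∀ r s → L ≡ 3 ℕ.* r ℕ.+ s → reflectionˡ r s ≈ reflectionʳ r
      reflection-inverse-free zero s L≡s = trans (*-congʳ (*-congʳ (*-congˡ (poch-≡ q q (≡.sym L≡s))))) (sym (*-identityʳ _))
      reflection-inverse-free (suc r) s L≡ = *-cancelʳ (*-≉0 F₃≉0 G≉0) (begin
        reflectionˡ (suc r) s * (F₃ * G)              ≈⟨ sym (*-assoc _ _ _) ⟩
        reflectionˡ (suc r) s * F₃ * G                ≈⟨ *-congʳ unfoldˡ ⟩
        reflectionˡ r (3 ℕ.+ s) * (cubic * (q ^ 3 * (a * Z))) * G  ≈⟨ *-assoc _ _ _ ⟩
        reflectionˡ r (3 ℕ.+ s) * (cubic * (q ^ 3 * (a * Z)) * G)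
          ≈⟨ *-cong (reflection-inverse-free r (3 ℕ.+ s) (≡.trans L≡ (3[r+1]+s r s))) step ⟩
        reflectionʳ r * (quartic * F₃)                ≈⟨ sym (*-assoc _ _ _) ⟩
        reflectionʳ r * quartic * F₃                  ≈⟨ *-congʳ unfoldʳ ⟩
        reflectionʳ (suc r) * G * F₃                  ≈⟨ *-assoc _ _ _ ⟩
        reflectionʳ (suc r) * (G * F₃)                ≈⟨ *-congˡ (*-comm G F₃) ⟩
        reflectionʳ (suc r) * (F₃ * G)                ∎)
        where open InductionStep r s L≡

      reflection : ∀ r s → L ≡ 3 ℕ.* r ℕ.+ s →
        poch (W ⁻¹) q (3 ℕ.* r) * q ^ (3 ℕ.* r) * poch q q s * poch a (q ^ 3) L
          ≈ a ^ r * q ^ (3 ℕ.* (r ℕ.* r)) * poch q q L * poch a (q ^ 3) (L ℕ.∸ r) * poch (q ^ 3 * Z ⁻¹ ÷ a) (q ^ 3) r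
      reflection r s L≡ = *-cancelʳ (*-≉0 (^-≉0 (3 ℕ.* r) W≉0) (^-≉0 r (*-≉0 a≉0 Z≉0))) (begin
        poch (W ⁻¹) q (3 ℕ.* r) * q ^ (3 ℕ.* r) * poch q q s * poch a (q ^ 3) L * (W ^ (3 ℕ.* r) * (a * Z) ^ r)
          ≈⟨ *-solve 6 (λ px qʳ pqs aPL Wʳ aZʳ →
               (((px ⊕ qʳ) ⊕ pqs) ⊕ aPL) ⊕ (Wʳ ⊕ aZʳ) ⊜ (((((px ⊕ Wʳ) ⊕ qʳ) ⊕ pqs) ⊕ aPL) ⊕ aZʳ)) refl _ _ _ _ _ _ ⟩
        poch (W ⁻¹) q (3 ℕ.* r) * W ^ (3 ℕ.* r) * q ^ (3 ℕ.* r) * poch q q s * poch a (q ^ 3) L * (a * Z) ^ r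
          ≈⟨ *-congʳ (*-congʳ (*-congʳ (*-congʳ (trans (poch-*-^ (W ⁻¹) q W (3 ℕ.* r))
                                                       (homogeneousPoch-cong W q (3 ℕ.* r) (⁻¹-inverseˡ W W≉0)))))) ⟩
        reflectionˡ r s
          ≈⟨ reflection-inverse-free r s L≡ ⟩
        reflectionʳ r
          ≈⟨ *-congʳ (*-congˡ (sym (trans (poch-*-^ y (q ^ 3) (a * Z) r) (homogeneousPoch-cong (a * Z) (q ^ 3) r y*aZ≈q³)))) ⟩
        a ^ r * q ^ (3 ℕ.* (r ℕ.* r)) * poch q q L * poch a (q ^ 3) (L ℕ.∸ r) * (poch y (q ^ 3) r * (a * Z) ^ r) * W ^ (3 ℕ.* r)
          ≈⟨ *-solve 7 (λ aʳ qʳʳ pqL aPLr py aZʳ Wʳ →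
               (((((aʳ ⊕ qʳʳ) ⊕ pqL) ⊕ aPLr) ⊕ (py ⊕ aZʳ)) ⊕ Wʳ) ⊜ ((((aʳ ⊕ qʳʳ) ⊕ pqL) ⊕ aPLr) ⊕ py) ⊕ (Wʳ ⊕ aZʳ))
             refl _ _ _ _ _ _ _ ⟩
        a ^ r * q ^ (3 ℕ.* (r ℕ.* r)) * poch q q L * poch a (q ^ 3) (L ℕ.∸ r) * poch y (q ^ 3) r * (W ^ (3 ℕ.* r) * (a * Z) ^ r) ∎)
        where
        y : Carrier
        y = q ^ 3 * Z ⁻¹ ÷ a
        W≉0 : W ≉ 0#
        W≉0 = ^-≉0 L q≉0
        Z≉0 : Z ≉ 0#
        Z≉0 = ^-≉0 (3 ℕ.* L) q≉0
        y*aZ≈q³ : y * (a * Z) ≈ q ^ 3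
        y*aZ≈q³ = begin
          q ^ 3 * Z ⁻¹ * a ⁻¹ * (a * Z)
            ≈⟨ *-solve 5 (λ p zi ai a z → ((p ⊕ zi) ⊕ ai) ⊕ (a ⊕ z) ⊜ p ⊕ ((z ⊕ zi) ⊕ (a ⊕ ai))) refl (q ^ 3) (Z ⁻¹) (a ⁻¹) a Z ⟩
          q ^ 3 * (Z * Z ⁻¹ * (a * a ⁻¹))     ≈⟨ *-congˡ (trans (*-cong (⁻¹-inverse Z Z≉0) (⁻¹-inverse a a≉0)) (*-identityˡ 1#)) ⟩
          q ^ 3 * 1#                          ≈⟨ *-identityʳ _ ⟩
          q ^ 3                               ∎

    module TermIdentity (L : ℕ) where
      open Reflection L

      baileyDenominator : Carrier → ℕ → ℕ → Carrier
      baileyDenominator p n r = poch p p (n ℕ.∸ r) * poch (a * p) p (n ℕ.+ r)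

      prefactor : Carrier
      prefactor = poch a (q ^ 3) L ÷ (poch q q L * poch a q (2 ℕ.* L))

      weight : ℕ → Carrier
      weight r = poch (W ⁻¹) q (3 ℕ.* r) * q ^ (3 ℕ.* r) ÷ poch (q ^ 3 * Z ⁻¹ ÷ a) (q ^ 3) r

      shifted : ℕ → Carrier
      shifted k = a * (q ^ 3) ^ (2 ℕ.* k)

      q³ⁱ⁺³≉1 : ∀ i → q ^ 3 * (q ^ 3) ^ i ≉ 1#
      q³ⁱ⁺³≉1 i = ≉-respˡ (trans (^-+ q 3 (3 ℕ.* i)) (*-congˡ (sym (^-^ q 3 i)))) (qⁿ⁺¹≉1 (2 ℕ.+ 3 ℕ.* i))

      shifted-q³ⁱ⁺³≉1 : ∀ k i → shifted k * q ^ 3 * (q ^ 3) ^ i ≉ 1#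
      shifted-q³ⁱ⁺³≉1 k i = ≉-respˡ (trans (*-congˡ (^-+ (q ^ 3) (2 ℕ.* k) (suc i)))
        (*-solve 4 (λ a u p v → a ⊕ (u ⊕ (p ⊕ v)) ⊜ ((a ⊕ u) ⊕ p) ⊕ v) refl a _ (q ^ 3) _)) (a[q³]ᵏ≉1 (2 ℕ.* k ℕ.+ suc i))

      module Key (k : ℕ) = KeyIdentity (shifted k) q q≉0 q³ⁱ⁺³≉1 (shifted-q³ⁱ⁺³≉1 k)

      shifted≈ : ∀ k → shifted k ≈ a * q ^ (3 ℕ.* (2 ℕ.* k))
      shifted≈ k = *-congˡ (^-^ q 3 (2 ℕ.* k))

      coefficient : ℕ → Carrier
      coefficient k = a ^ k * q ^ (3 ℕ.* (k ℕ.* k)) ÷ baileyDenominator q L (3 ℕ.* k)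

      keyFactor : ℕ → Carrier
      keyFactor k = poch (shifted k * q) q n ÷ poch (shifted k) q (2 ℕ.* n)
        where n = L ℕ.∸ 3 ℕ.* k

      term : ℕ → ℕ → Carrier
      term r k = prefactor * weight r ÷ baileyDenominator (q ^ 3) r k

      poch-q-≉0 : ∀ m → poch q q m ≉ 0#
      poch-q-≉0 m = poch-≉0 m (λ i _ → qⁿ⁺¹≉1 i)
      poch-a-≉0 : ∀ m → poch a q m ≉ 0#
      poch-a-≉0 m = poch-≉0 m (λ i _ → aqᵐ≉1 i)
      poch-aq-≉0 : ∀ m → poch (a * q) q m ≉ 0#
      poch-aq-≉0 m = poch-≉0 m (λ i _ → ≉-respˡ (sym (*-assoc a q (q ^ i))) (aqᵐ≉1 (suc i)))
      poch-q³-≉0 : ∀ m → poch (q ^ 3) (q ^ 3) m ≉ 0#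
      poch-q³-≉0 m = poch-≉0 m (λ i _ → q³ⁱ⁺³≉1 i)
      poch-aq³-≉0 : ∀ m → poch (a * q ^ 3) (q ^ 3) m ≉ 0#
      poch-aq³-≉0 m = poch-≉0 m (λ i _ → ≉-respˡ (sym (*-assoc a (q ^ 3) ((q ^ 3) ^ i))) (a[q³]ᵏ≉1 (suc i)))
      poch-shifted-≉0 : ∀ k m → poch (shifted k) q m ≉ 0#
      poch-shifted-≉0 k m = poch-≉0 m (λ i _ → ≉-respˡ (trans (*-congˡ (^-+ q (3 ℕ.* (2 ℕ.* k)) i))
        (trans (sym (*-assoc _ _ _)) (*-congʳ (sym (shifted≈ k))))) (aqᵐ≉1 (3 ℕ.* (2 ℕ.* k) ℕ.+ i)))
      -- (q^(3−3L)/a; q³)_r has no zero factor as long as r ≤ L: a factor 1 − q^(3+3i−3L)/a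
      -- with i < L vanishes iff a q^(3(L−1−i)) = 1.
      poch-y-≉0 : ∀ r → r ℕ.≤ L → poch (q ^ 3 * Z ⁻¹ ÷ a) (q ^ 3) r ≉ 0#
      poch-y-≉0 r r≤L = poch-≉0 r (λ i i<r y[q³]ⁱ≈1 → a[q³]ᵏ≉1 (L ℕ.∸ suc i) (begin
        a * (q ^ 3) ^ (L ℕ.∸ suc i)                     ≈⟨ sym (*-identityˡ _) ⟩
        1# * (a * (q ^ 3) ^ (L ℕ.∸ suc i))              ≈⟨ *-congʳ (sym y[q³]ⁱ≈1) ⟩
        q ^ 3 * Z ⁻¹ * a ⁻¹ * (q ^ 3) ^ i * (a * (q ^ 3) ^ (L ℕ.∸ suc i))
          ≈⟨ *-solve 6 (λ p zi ai u a v → (((p ⊕ zi) ⊕ ai) ⊕ u) ⊕ (a ⊕ v) ⊜ ((p ⊕ (u ⊕ v)) ⊕ zi) ⊕ (a ⊕ ai))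
               refl (q ^ 3) (Z ⁻¹) (a ⁻¹) ((q ^ 3) ^ i) a ((q ^ 3) ^ (L ℕ.∸ suc i)) ⟩
        q ^ 3 * ((q ^ 3) ^ i * (q ^ 3) ^ (L ℕ.∸ suc i)) * Z ⁻¹ * (a * a ⁻¹)
          ≈⟨ *-cong (*-congʳ (*-congˡ (sym (^-+ (q ^ 3) i (L ℕ.∸ suc i))))) (⁻¹-inverse a a≉0) ⟩
        (q ^ 3) ^ (suc i ℕ.+ (L ℕ.∸ suc i)) * Z ⁻¹ * 1#
          ≈⟨ *-congʳ (*-congʳ (trans (^-≡ (q ^ 3) (ℕ.m+[n∸m]≡n (ℕ.≤-trans i<r r≤L))) (^-^ q 3 L))) ⟩
        Z * Z ⁻¹ * 1#                                   ≈⟨ trans (*-identityʳ _) (⁻¹-inverse Z (^-≉0 (3 ℕ.* L) q≉0)) ⟩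
        1#                                              ∎))

      private
        L-split : ∀ k j s → 3 ℕ.* (k ℕ.+ j) ℕ.+ s ≡ (3 ℕ.* j ℕ.+ s) ℕ.+ 3 ℕ.* k
        L-split = solve-∀
        L-split′ : ∀ k j s → 3 ℕ.* (k ℕ.+ j) ℕ.+ s ≡ (2 ℕ.* k ℕ.+ (2 ℕ.* j ℕ.+ s)) ℕ.+ (k ℕ.+ j)
        L-split′ = solve-∀
        n-split : ∀ j s → 3 ℕ.* j ℕ.+ s ≡ (2 ℕ.* j ℕ.+ s) ℕ.+ j
        n-split = solve-∀
        r+k≡ : ∀ k j → (k ℕ.+ j) ℕ.+ k ≡ 2 ℕ.* k ℕ.+ j
        r+k≡ = solve-∀
        L+3k≡ : ∀ k j s → (3 ℕ.* (k ℕ.+ j) ℕ.+ s) ℕ.+ 3 ℕ.* k ≡ 3 ℕ.* (2 ℕ.* k) ℕ.+ (3 ℕ.* j ℕ.+ s)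
        L+3k≡ = solve-∀
        2L≡ : ∀ k j s → 2 ℕ.* (3 ℕ.* (k ℕ.+ j) ℕ.+ s) ≡ 3 ℕ.* (2 ℕ.* k) ℕ.+ 2 ℕ.* (3 ℕ.* j ℕ.+ s)
        2L≡ = solve-∀
        square-split : ∀ k j → 3 ℕ.* ((k ℕ.+ j) ℕ.* (k ℕ.+ j)) ≡ 3 ℕ.* (k ℕ.* k) ℕ.+ (3 ℕ.* (j ℕ.* (2 ℕ.* k)) ℕ.+ 3 ℕ.* (j ℕ.* j))
        square-split = solve-∀
        +-swapʳ : ∀ x y z → x ℕ.+ y ℕ.+ z ≡ x ℕ.+ z ℕ.+ y
        +-swapʳ = solve-∀

        module Factorisation (k j s : ℕ) (L≡ : L ≡ 3 ℕ.* (k ℕ.+ j) ℕ.+ s) where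
          r n : ℕ
          r = k ℕ.+ j
          n = L ℕ.∸ 3 ℕ.* k
          b px qʳ yP aPL qqL aq2L q³q³ʳ⁻ᵏ aq³ʳ⁺ᵏ qqn aqL3k aᵏ q³ᵏᵏ bʲ q³ʲʲ bPⁿ⁻ʲ fl q³q³ʲ bq³ʲ bqn b2n qqs : Carrier
          b = shifted k
          px = poch (W ⁻¹) q (3 ℕ.* r)
          qʳ = q ^ (3 ℕ.* r)
          yP = poch (q ^ 3 * Z ⁻¹ ÷ a) (q ^ 3) r
          aPL = poch a (q ^ 3) L
          qqL = poch q q L
          aq2L = poch a q (2 ℕ.* L)
          q³q³ʳ⁻ᵏ = poch (q ^ 3) (q ^ 3) (r ℕ.∸ k)
          aq³ʳ⁺ᵏ = poch (a * q ^ 3) (q ^ 3) (r ℕ.+ k)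
          qqn = poch q q n
          aqL3k = poch (a * q) q (L ℕ.+ 3 ℕ.* k)
          aᵏ = a ^ k
          q³ᵏᵏ = q ^ (3 ℕ.* (k ℕ.* k))
          bʲ = b ^ j
          q³ʲʲ = q ^ (3 ℕ.* (j ℕ.* j))
          bPⁿ⁻ʲ = poch b (q ^ 3) (n ℕ.∸ j)
          fl = falling q n (3 ℕ.* j)
          q³q³ʲ = poch (q ^ 3) (q ^ 3) j
          bq³ʲ = poch (b * q ^ 3) (q ^ 3) j
          bqn = poch (b * q) q n
          b2n = poch b q (2 ℕ.* n)
          qqs = poch q q s
          r≤L : r ℕ.≤ L
          r≤L = ≡.subst (r ℕ.≤_) (≡.sym L≡) (ℕ.≤-trans (ℕ.m≤m+n r (r ℕ.+ (r ℕ.+ 0))) (ℕ.m≤m+n (3 ℕ.* r) s))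
          a-q³-2k aq³-q³-2k a-q-6k aq-q-6k : Carrier
          a-q³-2k = poch a (q ^ 3) (2 ℕ.* k)
          aq³-q³-2k = poch (a * q ^ 3) (q ^ 3) (2 ℕ.* k)
          a-q-6k = poch a q (3 ℕ.* (2 ℕ.* k))
          aq-q-6k = poch (a * q) q (3 ℕ.* (2 ℕ.* k))
          n≡ : n ≡ 3 ℕ.* j ℕ.+ s
          n≡ = ≡.trans (≡.cong (ℕ._∸ 3 ℕ.* k) (≡.trans L≡ (L-split k j s))) (ℕ.m+n∸n≡m _ (3 ℕ.* k))
          powers-split : a ^ r * q ^ (3 ℕ.* (r ℕ.* r)) ≈ aᵏ * q³ᵏᵏ * (bʲ * q³ʲʲ)
          powers-split = trans (*-cong (^-+ a k j) (trans (^-≡ q (square-split k j))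
                           (trans (^-+ q (3 ℕ.* (k ℕ.* k)) _) (*-congˡ (^-+ q (3 ℕ.* (j ℕ.* (2 ℕ.* k))) (3 ℕ.* (j ℕ.* j)))))))
            (trans (*-solve 5 (λ a b c d e → (a ⊕ b) ⊕ (c ⊕ (d ⊕ e)) ⊜ (a ⊕ c) ⊕ ((b ⊕ d) ⊕ e)) refl aᵏ (a ^ j) q³ᵏᵏ _ q³ʲʲ)
                   (*-congˡ (*-congʳ (sym bʲ≈))))
            where
            bʲ≈ : bʲ ≈ a ^ j * q ^ (3 ℕ.* (j ℕ.* (2 ℕ.* k)))
            bʲ≈ = trans (*-^ a ((q ^ 3) ^ (2 ℕ.* k)) j) (*-congˡ (trans (sym (^-* (q ^ 3) j (2 ℕ.* k))) (^-^ q 3 (j ℕ.* (2 ℕ.* k)))))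
          a-q³-split : poch a (q ^ 3) (L ℕ.∸ r) ≈ a-q³-2k * bPⁿ⁻ʲ
          a-q³-split = trans (poch-≡ a (q ^ 3) L∸r≡) (poch-+ a (q ^ 3) (2 ℕ.* k) (n ℕ.∸ j))
            where
            L∸r≡ : L ℕ.∸ r ≡ 2 ℕ.* k ℕ.+ (n ℕ.∸ j)
            L∸r≡ = ≡.trans (≡.trans (≡.cong (ℕ._∸ r) (≡.trans L≡ (L-split′ k j s))) (ℕ.m+n∸n≡m _ r))
                     (≡.cong (2 ℕ.* k ℕ.+_) (≡.sym (≡.trans (≡.cong (ℕ._∸ j) (≡.trans n≡ (n-split j s))) (ℕ.m+n∸n≡m _ j))))
          aq³-q³-split : aq³ʳ⁺ᵏ ≈ aq³-q³-2k * bq³ʲ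
          aq³-q³-split = trans (poch-≡ (a * q ^ 3) (q ^ 3) (r+k≡ k j)) (trans (poch-+ (a * q ^ 3) (q ^ 3) (2 ℕ.* k) j)
            (*-congˡ (poch-cong (q ^ 3) j (*-solve 3 (λ a p u → (a ⊕ p) ⊕ u ⊜ (a ⊕ u) ⊕ p) refl a (q ^ 3) _))))
          q³-q³-shift : q³q³ʳ⁻ᵏ ≈ q³q³ʲ
          q³-q³-shift = poch-≡ (q ^ 3) (q ^ 3) (ℕ.m+n∸m≡n k j)
          falling-poch′ : fl * qqs ≈ qqn
          falling-poch′ = trans (*-congˡ (poch-≡ q q (≡.sym n∸3j≡s)))
            (falling-poch q n (3 ℕ.* j) (≡.subst (3 ℕ.* j ℕ.≤_) (≡.sym n≡) (ℕ.m≤m+n _ s)))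
            where
            n∸3j≡s : n ℕ.∸ 3 ℕ.* j ≡ s
            n∸3j≡s = ≡.trans (≡.cong (ℕ._∸ 3 ℕ.* j) n≡) (ℕ.m+n∸m≡n (3 ℕ.* j) s)
          aq-q-split : aqL3k ≈ aq-q-6k * bqn
          aq-q-split = trans (poch-≡ (a * q) q (≡.trans (≡.cong (ℕ._+ 3 ℕ.* k) L≡)
                                                (≡.trans (L+3k≡ k j s) (≡.cong (3 ℕ.* (2 ℕ.* k) ℕ.+_) (≡.sym n≡)))))
            (trans (poch-+ (a * q) q (3 ℕ.* (2 ℕ.* k)) n)
              (*-congˡ (poch-cong q n (trans (*-solve 3 (λ a q u → (a ⊕ q) ⊕ u ⊜ (a ⊕ u) ⊕ q) refl a q _) (*-congʳ (sym (shifted≈ k)))))))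
          a-q-split : aq2L ≈ a-q-6k * b2n
          a-q-split = trans (poch-≡ a q (≡.trans (≡.cong (2 ℕ.*_) L≡)
                                         (≡.trans (2L≡ k j s) (≡.cong (λ m → 3 ℕ.* (2 ℕ.* k) ℕ.+ 2 ℕ.* m) (≡.sym n≡)))))
            (trans (poch-+ a q (3 ℕ.* (2 ℕ.* k)) (2 ℕ.* n)) (*-congˡ (poch-cong q (2 ℕ.* n) (sym (shifted≈ k)))))
          qqL*aq2L≉0 : qqL * aq2L ≉ 0#
          qqL*aq2L≉0 = *-≉0 (poch-q-≉0 L) (poch-a-≉0 (2 ℕ.* L))
          yP≉0 : yP ≉ 0#
          yP≉0 = poch-y-≉0 r r≤L
          q³q³*aq³≉0 : q³q³ʳ⁻ᵏ * aq³ʳ⁺ᵏ ≉ 0#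
          q³q³*aq³≉0 = *-≉0 (poch-q³-≉0 (r ℕ.∸ k)) (poch-aq³-≉0 (r ℕ.+ k))
          qqn*aqL3k≉0 : qqn * aqL3k ≉ 0#
          qqn*aqL3k≉0 = *-≉0 (poch-q-≉0 n) (poch-aq-≉0 (L ℕ.+ 3 ℕ.* k))
          Dʲ≉0 : q³q³ʲ * bq³ʲ ≉ 0#
          Dʲ≉0 = Key.denominator-≉0 k j
          b2n≉0 : b2n ≉ 0#
          b2n≉0 = poch-shifted-≉0 k (2 ℕ.* n)
          -- After reflection, every Pochhammer symbol is split at length 2k (base q³) or 6k (base q);
          -- the pieces of length 2k and 6k then match by poch-swap.
          cross-multiplied : aPL * (px * qʳ) * (qqn * aqL3k * (q³q³ʲ * bq³ʲ * b2n))
                             ≈ aᵏ * q³ᵏᵏ * (bʲ * q³ʲʲ * bPⁿ⁻ʲ * fl * bqn) * (qqL * aq2L * yP * (q³q³ʳ⁻ᵏ * aq³ʳ⁺ᵏ))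
          cross-multiplied = *-cancelʳ (poch-q-≉0 s) (begin
            aPL * (px * qʳ) * (qqn * aqL3k * (q³q³ʲ * bq³ʲ * b2n)) * qqs
              ≈⟨ *-solve 9 (λ aPL px qr qqn aqL3k PPj bPPj bq2n qqs →
                   (((aPL ⊕ (px ⊕ qr)) ⊕ ((qqn ⊕ aqL3k) ⊕ ((PPj ⊕ bPPj) ⊕ bq2n))) ⊕ qqs)
                   ⊜ ((((px ⊕ qr) ⊕ qqs) ⊕ aPL) ⊕ ((((qqn ⊕ aqL3k) ⊕ PPj) ⊕ bPPj) ⊕ bq2n))) refl _ _ _ _ _ _ _ _ _ ⟩
            px * qʳ * qqs * aPL * (qqn * aqL3k * q³q³ʲ * bq³ʲ * b2n)
              ≈⟨ *-congʳ (reflection r s L≡) ⟩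
            a ^ r * q ^ (3 ℕ.* (r ℕ.* r)) * qqL * poch a (q ^ 3) (L ℕ.∸ r) * yP * (qqn * aqL3k * q³q³ʲ * bq³ʲ * b2n)
              ≈⟨ *-cong (*-congʳ (*-cong (*-congʳ powers-split) a-q³-split)) (*-congʳ (*-congʳ (*-congʳ (*-congˡ aq-q-split)))) ⟩
            aᵏ * q³ᵏᵏ * (bʲ * q³ʲʲ) * qqL * (a-q³-2k * bPⁿ⁻ʲ) * yP * (qqn * (aq-q-6k * bqn) * q³q³ʲ * bq³ʲ * b2n)
              ≈⟨ *-solve 14 (λ ak q3k bj q3j qqL aP2k bPnj yP qqn aqq6k bqn PPj bPPj bq2n →
                   ((((((ak ⊕ q3k) ⊕ (bj ⊕ q3j)) ⊕ qqL) ⊕ (aP2k ⊕ bPnj)) ⊕ yP) ⊕ ((((qqn ⊕ (aqq6k ⊕ bqn)) ⊕ PPj) ⊕ bPPj) ⊕ bq2n))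
                   ⊜ ((aP2k ⊕ aqq6k) ⊕ (((((((((((ak ⊕ q3k) ⊕ bj) ⊕ q3j) ⊕ qqL) ⊕ bPnj) ⊕ yP) ⊕ qqn) ⊕ bqn) ⊕ PPj) ⊕ bPPj) ⊕ bq2n)))
                 refl _ _ _ _ _ _ _ _ _ _ _ _ _ _ ⟩
            a-q³-2k * aq-q-6k * (aᵏ * q³ᵏᵏ * bʲ * q³ʲʲ * qqL * bPⁿ⁻ʲ * yP * qqn * bqn * q³q³ʲ * bq³ʲ * b2n)
              ≈⟨ *-congʳ (poch-swap a q (q ^ 3) (2 ℕ.* k) (3 ℕ.* (2 ℕ.* k)) (^-^ q 3 (2 ℕ.* k)) (a[q³]ᵏ≉1 (2 ℕ.* k))) ⟩
            a-q-6k * aq³-q³-2k * (aᵏ * q³ᵏᵏ * bʲ * q³ʲʲ * qqL * bPⁿ⁻ʲ * yP * qqn * bqn * q³q³ʲ * bq³ʲ * b2n)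
              ≈⟨ *-solve 14 (λ ak q3k bj q3j bPnj qqn bqn qqL aq6k bq2n yP PPj aPP2k bPPj →
                   ((aq6k ⊕ aPP2k) ⊕ (((((((((((ak ⊕ q3k) ⊕ bj) ⊕ q3j) ⊕ qqL) ⊕ bPnj) ⊕ yP) ⊕ qqn) ⊕ bqn) ⊕ PPj) ⊕ bPPj) ⊕ bq2n))
                   ⊜ ((((((ak ⊕ q3k) ⊕ ((bj ⊕ q3j) ⊕ bPnj)) ⊕ qqn) ⊕ bqn) ⊕ ((qqL ⊕ (aq6k ⊕ bq2n)) ⊕ yP)) ⊕ (PPj ⊕ (aPP2k ⊕ bPPj))))
                 refl _ _ _ _ _ _ _ _ _ _ _ _ _ _ ⟩
            aᵏ * q³ᵏᵏ * (bʲ * q³ʲʲ * bPⁿ⁻ʲ) * qqn * bqn * (qqL * (a-q-6k * b2n) * yP) * (q³q³ʲ * (aq³-q³-2k * bq³ʲ))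
              ≈⟨ sym (*-cong (*-cong (*-congʳ (*-congˡ (falling-poch′))) (*-congʳ (*-congˡ a-q-split))) (*-cong q³-q³-shift aq³-q³-split)) ⟩
            aᵏ * q³ᵏᵏ * (bʲ * q³ʲʲ * bPⁿ⁻ʲ) * (fl * qqs) * bqn * (qqL * aq2L * yP) * (q³q³ʳ⁻ᵏ * aq³ʳ⁺ᵏ)
              ≈⟨ *-solve 13 (λ ak q3k bj q3j bPnj fl bqn qqL aq2L yP PPj′ aPrk qqs →
                   ((((((ak ⊕ q3k) ⊕ ((bj ⊕ q3j) ⊕ bPnj)) ⊕ (fl ⊕ qqs)) ⊕ bqn) ⊕ ((qqL ⊕ aq2L) ⊕ yP)) ⊕ (PPj′ ⊕ aPrk))
                   ⊜ ((((ak ⊕ q3k) ⊕ ((((bj ⊕ q3j) ⊕ bPnj) ⊕ fl) ⊕ bqn)) ⊕ (((qqL ⊕ aq2L) ⊕ yP) ⊕ (PPj′ ⊕ aPrk))) ⊕ qqs))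
                 refl _ _ _ _ _ _ _ _ _ _ _ _ _ ⟩
            aᵏ * q³ᵏᵏ * (bʲ * q³ʲʲ * bPⁿ⁻ʲ * fl * bqn) * (qqL * aq2L * yP * (q³q³ʳ⁻ᵏ * aq³ʳ⁺ᵏ)) * qqs ∎)

      term-identity : ∀ k j s → L ≡ 3 ℕ.* (k ℕ.+ j) ℕ.+ s →
        term (k ℕ.+ j) k ≈ coefficient k * ((Key.summand k (L ℕ.∸ 3 ℕ.* k) j ÷ Key.denominator k j) * keyFactor k)
      term-identity k j s L≡ = begin
        term r k
          ≈⟨ trans (*-congʳ (÷-*-÷ aPL (px * qʳ) qqL*aq2L≉0 yP≉0)) (÷-÷ _ (*-≉0 qqL*aq2L≉0 yP≉0) q³q³*aq³≉0) ⟩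
        aPL * (px * qʳ) ÷ (qqL * aq2L * yP * (q³q³ʳ⁻ᵏ * aq³ʳ⁺ᵏ))
          ≈⟨ ÷-cross (*-≉0 (*-≉0 qqL*aq2L≉0 yP≉0) q³q³*aq³≉0) (*-≉0 qqn*aqL3k≉0 (*-≉0 Dʲ≉0 b2n≉0)) cross-multiplied ⟩
        aᵏ * q³ᵏᵏ * (bʲ * q³ʲʲ * bPⁿ⁻ʲ * fl * bqn) ÷ (qqn * aqL3k * (q³q³ʲ * bq³ʲ * b2n))
          ≈⟨ sym (trans (*-congˡ (÷-*-÷ _ _ Dʲ≉0 b2n≉0)) (÷-*-÷ _ _ qqn*aqL3k≉0 (*-≉0 Dʲ≉0 b2n≉0))) ⟩
        coefficient k * ((Key.summand k n j ÷ Key.denominator k j) * keyFactor k) ∎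
        where open Factorisation k j s L≡

      M : ℕ
      M = L / 3

      3M≤L : 3 ℕ.* M ℕ.≤ L
      3M≤L = ≡.subst (ℕ._≤ L) (ℕ.*-comm M 3) (≡.subst (M ℕ.* 3 ℕ.≤_) (≡.sym (m≡m%n+[m/n]*n L 3)) (ℕ.m≤n+m (M ℕ.* 3) (L % 3)))

      L<3[M+1] : L ℕ.< 3 ℕ.* suc M
      L<3[M+1] = ≡.subst₂ ℕ._<_ (≡.sym (m≡m%n+[m/n]*n L 3)) (≡.trans (≡.cong (3 ℕ.+_) (ℕ.*-comm M 3)) (≡.sym (ℕ.*-suc 3 M)))
                          (ℕ.+-monoˡ-< (M ℕ.* 3) (m%n<n L 3))

      coefficient-sum : ∀ k → k ℕ.≤ M → sumTo (M ℕ.∸ k) (λ j → term (k ℕ.+ j) k) ≈ coefficient k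
      coefficient-sum k k≤M = begin
        sumTo (M ℕ.∸ k) (λ j → term (k ℕ.+ j) k)
          ≈⟨ sumTo-cong (M ℕ.∸ k) (λ j j≤ → term-identity k j (L ℕ.∸ 3 ℕ.* (k ℕ.+ j)) (≡.sym (ℕ.m+[n∸m]≡n (3[k+j]≤L j j≤)))) ⟩
        sumTo (M ℕ.∸ k) (λ j → coefficient k * (f j * keyFactor k))
          ≈⟨ sym (*-distribˡ-sumTo (coefficient k) (M ℕ.∸ k) _) ⟩
        coefficient k * sumTo (M ℕ.∸ k) (λ j → f j * keyFactor k)
          ≈⟨ *-congˡ (sym (*-distribʳ-sumTo (keyFactor k) (M ℕ.∸ k) f)) ⟩
        coefficient k * (sumTo (M ℕ.∸ k) f * keyFactor k)
          ≈⟨ *-congˡ (*-congʳ (sym keySum-truncate)) ⟩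
        coefficient k * (Key.keySum k n * keyFactor k)
          ≈⟨ *-congˡ (trans (sym (*-assoc _ _ _)) (÷-intro (poch-shifted-≉0 k (2 ℕ.* n)) (trans (Key.key-identity k n) (sym (*-identityˡ _))))) ⟩
        coefficient k * 1#
          ≈⟨ *-identityʳ _ ⟩
        coefficient k ∎
        where
        n : ℕ
        n = L ℕ.∸ 3 ℕ.* k
        f : ℕ → Carrier
        f j = Key.summand k n j ÷ Key.denominator k j
        3k≤L : 3 ℕ.* k ℕ.≤ L
        3k≤L = ℕ.≤-trans (ℕ.*-monoʳ-≤ 3 k≤M) 3M≤L
        3[k+j]≤L : ∀ j → j ℕ.≤ M ℕ.∸ k → 3 ℕ.* (k ℕ.+ j) ℕ.≤ L
        3[k+j]≤L j j≤ = ℕ.≤-trans (ℕ.*-monoʳ-≤ 3 (ℕ.≤-trans (ℕ.+-monoʳ-≤ k j≤) (ℕ.≤-reflexive (ℕ.m+[n∸m]≡n k≤M)))) 3M≤L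
        M∸k≤n : M ℕ.∸ k ℕ.≤ n
        M∸k≤n = ℕ.≤-trans (ℕ.m≤n*m (M ℕ.∸ k) 3) (ℕ.m+n≤o⇒m≤o∸n (3 ℕ.* (M ℕ.∸ k))
                  (ℕ.≤-trans (ℕ.≤-reflexive (≡.trans (≡.sym (ℕ.*-distribˡ-+ 3 (M ℕ.∸ k) k)) (≡.cong (3 ℕ.*_) (ℕ.m∸n+n≡m k≤M)))) 3M≤L))
        -- beyond j = M − k the summand contains the factor falling q n (3j) with 3j > n
        n<3[M∸k+i] : ∀ i → 0 ℕ.< i → n ℕ.< 3 ℕ.* (M ℕ.∸ k ℕ.+ i)
        n<3[M∸k+i] i 0<i = ℕ.+-cancelʳ-≤ (3 ℕ.* k) (suc n) _
          (ℕ.≤-trans (ℕ.≤-reflexive (≡.cong suc (ℕ.m∸n+n≡m 3k≤L)))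
          (ℕ.≤-trans L<3[M+1]
          (ℕ.≤-trans (ℕ.*-monoʳ-≤ 3 M+1≤) (ℕ.≤-reflexive (ℕ.*-distribˡ-+ 3 (M ℕ.∸ k ℕ.+ i) k)))))
          where
          M+1≤ : suc M ℕ.≤ M ℕ.∸ k ℕ.+ i ℕ.+ k
          M+1≤ = ℕ.≤-trans (ℕ.≤-reflexive (ℕ.+-comm 1 M)) (ℕ.≤-trans (ℕ.+-monoʳ-≤ M 0<i)
                   (ℕ.≤-reflexive (≡.trans (≡.cong (ℕ._+ i) (≡.sym (ℕ.m∸n+n≡m k≤M))) (+-swapʳ (M ℕ.∸ k) k i))))
        keySum-truncate : Key.keySum k n ≈ sumTo (M ℕ.∸ k) f
        keySum-truncate = trans (sumTo-≡ f (≡.sym (ℕ.m+[n∸m]≡n M∸k≤n)))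
          (sumTo-pad (M ℕ.∸ k) (n ℕ.∸ (M ℕ.∸ k)) f (λ i 0<i _ → *-≈0ˡ _ (*-≈0ʳ _ (falling-≈0 q (n<3[M∸k+i] i 0<i)))))

    module BaileyTransform (α β : ℕ → Carrier) (bailey : BaileyPair a (q ^ 3) α β) (L : ℕ) where
      open TermIdentity L

      private
        alphaPrime-residue₀ : ∀ n → n % 3 ≡ 0 → alphaPrime a q α n ≡ a ^ (n / 3) * q ^ (3 ℕ.* ((n / 3) ℕ.* (n / 3))) * α (n / 3)
        alphaPrime-residue₀ n n%3≡0 rewrite n%3≡0 = ≡.refl

        alphaPrime-residue₊ : ∀ n {m} → n % 3 ≡ suc m → alphaPrime a q α n ≡ 0#
        alphaPrime-residue₊ n n%3≡1+m rewrite n%3≡1+m = ≡.refl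

      alphaPrime-multiple : ∀ k → alphaPrime a q α (3 ℕ.* k) ≡ a ^ k * q ^ (3 ℕ.* (k ℕ.* k)) * α k
      alphaPrime-multiple k = ≡.trans (alphaPrime-residue₀ (3 ℕ.* k) (≡.trans (≡.cong (_% 3) (ℕ.*-comm 3 k)) (m*n%n≡0 k 3)))
        (≡.cong (λ m → a ^ m * q ^ (3 ℕ.* (m ℕ.* m)) * α m) (≡.trans (≡.cong (_/ 3) (ℕ.*-comm 3 k)) (m*n/n≡m k 3)))

      alphaPrime-non-multiple : ∀ k r → 0 ℕ.< r → r ℕ.< 3 → alphaPrime a q α (3 ℕ.* k ℕ.+ r) ≡ 0#
      alphaPrime-non-multiple k r@(suc r′) _ r<3 = alphaPrime-residue₊ (3 ℕ.* k ℕ.+ r) {r′} (≡.trans (≡.cong (_% 3) 3k+r≡) (residue r′ r<3))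
        where
        3k+r≡ : 3 ℕ.* k ℕ.+ r ≡ r ℕ.+ k ℕ.* 3
        3k+r≡ = ≡.trans (ℕ.+-comm (3 ℕ.* k) r) (≡.cong (r ℕ.+_) (ℕ.*-comm 3 k))
        residue : ∀ r′ → suc r′ ℕ.< 3 → (suc r′ ℕ.+ k ℕ.* 3) % 3 ≡ suc r′
        residue 0 _ = [m+kn]%n≡m%n 1 k 3
        residue 1 _ = [m+kn]%n≡m%n 2 k 3
        residue (suc (suc _)) (s≤s (s≤s (s≤s ())))

      transformed : betaPrime a q β L ≈ sumTo L (λ n → alphaPrime a q α n ÷ baileyDenominator q L n)
      transformed = begin
        prefactor * sumTo M (λ r → weight r * β r)
          ≈⟨ *-congˡ (sumTo-cong M (λ r _ → *-congˡ (bailey r))) ⟩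
        prefactor * sumTo M (λ r → weight r * sumTo r (λ k → α k ÷ baileyDenominator (q ^ 3) r k))
          ≈⟨ *-distribˡ-sumTo prefactor M _ ⟩
        sumTo M (λ r → prefactor * (weight r * sumTo r (λ k → α k ÷ baileyDenominator (q ^ 3) r k)))
          ≈⟨ sumTo-cong M (λ r _ → distribute r) ⟩
        sumTo M (λ r → sumTo r (λ k → α k * term r k))
          ≈⟨ sumTo-triangle M (λ r k → α k * term r k) ⟩
        sumTo M (λ k → sumTo (M ℕ.∸ k) (λ j → α k * term (k ℕ.+ j) k))
          ≈⟨ sumTo-cong M (λ k k≤M → trans (sym (*-distribˡ-sumTo (α k) (M ℕ.∸ k) _)) (*-congˡ (coefficient-sum k k≤M))) ⟩
        sumTo M (λ k → α k * coefficient k)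
          ≈⟨ sumTo-cong M (λ k _ → α-coefficient k) ⟩
        sumTo M (λ k → g (3 ℕ.* k))
          ≈⟨ sym (sumTo-multiples 3 g (λ k r 0<r r<3 → *-≈0ˡ _ (reflexive (alphaPrime-non-multiple k r 0<r r<3))) L) ⟩
        sumTo L g ∎
        where
        g : ℕ → Carrier
        g n = alphaPrime a q α n ÷ baileyDenominator q L n
        distribute : ∀ r → prefactor * (weight r * sumTo r (λ k → α k ÷ baileyDenominator (q ^ 3) r k))
                           ≈ sumTo r (λ k → α k * term r k)
        distribute r = trans (sym (*-assoc _ _ _)) (trans (*-distribˡ-sumTo (prefactor * weight r) r _)
          (sumTo-cong r (λ k _ → *-solve 3 (λ c a e → c ⊕ (a ⊕ e) ⊜ a ⊕ (c ⊕ e)) refl _ (α k) _)))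
        α-coefficient : ∀ k → α k * coefficient k ≈ g (3 ℕ.* k)
        α-coefficient k = trans (*-solve 4 (λ α A Q d → α ⊕ ((A ⊕ Q) ⊕ d) ⊜ ((A ⊕ Q) ⊕ α) ⊕ d) refl (α k) (a ^ k) _ _)
          (*-congʳ (sym (reflexive (alphaPrime-multiple k))))

lemma5p7 : ∀ {c ℓ} (F : Field c ℓ) → let open Field F in let open FieldOps F in
    (a q : Carrier) →
    ¬ (a ≈ 0#) → ¬ (q ≈ 0#) →
    (∀ n → ¬ (q ^ suc n ≈ 1#)) →
    (∀ m → ¬ (a ≈ q ^ m)) →
    (∀ m → ¬ (a * q ^ m ≈ 1#)) →
    (α β : ℕ → Carrier) →
    BaileyPair a (q ^ 3) α β →
    BaileyPair a q (alphaPrime a q α) (betaPrime a q β)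
lemma5p7 F a q a≉0 q≉0 qⁿ⁺¹≉1 _ aqᵐ≉1 α β bailey L = BaileyTransform.transformed F a q a≉0 q≉0 qⁿ⁺¹≉1 aqᵐ≉1 α β bailey L
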